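{- Let $G$ and $H$ be finite simple graphs, each having at least one edge. If the lexicographic product $G\circ H$ is well-f-covered, then: (1) $G$ is well-covered; and if every maximal forest of $G$ has no isolated vertex and $H$ has a maximal independent set of size $1$, then $G$ is well-f-covered and $f(G)=f(G\circ H)$; (2) $H$ is well-f-covered; and if $G$ has a maximal forest with at least one leaf, then $H$ is well-covered; (3) $f(G\circ H)=\alpha(G)\,f(H)$; (4) for every maximal forest $F$ of $G$ and every maximal independent set $M_H$ of $H$, \[f(H)\,I(F)+|M_H|\bigl(K_{2}(F)+L(F)\bigr)+K_{2}(F)+L'(F)=f(G\circ H),\] where $I(F)$ is the number of isolated vertices of $F$, $K_{2}(F)$ is the number of connected components of $F$ isomorphic to $K_{2}$, $L(F)$ is the number of leaves (vertices of degree $1$) lying in components of $F$ that are not isomorphic to $K_2$, and $L'(F)$ is the number of vertices of degree at least $2$ in $F$.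
   Context: All graphs are finite and simple. The lexicographic product $G\circ H$ has vertex set $V(G)\times V(H)$, with $(g,h)$ adjacent to $(g',h')$ if and only if either $g$ is adjacent to $g'$ in $G$, or $g=g'$ and $h$ is adjacent to $h'$ in $H$. A forest in a graph $G$ means an induced subgraph $G[X]$ ($X\subseteq V(G)$) containing no cycle; it is a maximal forest if no vertex set properly containing $X$ induces an acyclic subgraph. The forest number $f(G)$ is the maximum order of a forest in $G$. A graph is well-f-covered if all its maximal forests have the same order (necessarily $f(G)$). A leaf of a forest is a vertex of degree $1$ in it. $\alpha(G)$ denotes the independence number of $G$, and $G$ is well-covered if all its maximal independent sets have the same size. -}

module Defs where

open import Data.Nat using (ℕ; zero; suc; _+_; _*_; _≤_; _≡ᵇ_; _<ᵇ_)
open import Data.Bool using (Bool; true; false; _∧_; _∨_; not; if_then_else_)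
open import Data.Fin using (Fin; zero; suc; toℕ; inject₁; fromℕ; remQuot; _≟_)
open import Data.Product using (Σ; ∃; _×_; _,_; proj₁; proj₂)
open import Relation.Binary.PropositionalEquality using (_≡_)
open import Relation.Nullary.Decidable using (⌊_⌋)
open import Relation.Nullary using (¬_)
open import Function.Definitions using (Injective)

Graph : ℕ → Set
Graph n = Fin n → Fin n → Bool

IsSimple : ∀ {n} → Graph n → Set
IsSimple {n} G = (∀ u v → G u v ≡ G v u) × (∀ v → G v v ≡ false)

HasEdge : ∀ {n} → Graph n → Set
HasEdge G = Σ _ λ u → Σ _ λ v → G u v ≡ true

VSet : ℕ → Set
VSet n = Fin n → Bool

count : ∀ {n} → (Fin n → Bool) → ℕ
count {zero}  p = 0
count {suc n} p = (if p zero then 1 else 0) + count (λ i → p (suc i))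

anyB : ∀ {n} → (Fin n → Bool) → Bool
anyB {zero}  p = false
anyB {suc n} p = p zero ∨ anyB (λ i → p (suc i))

sumF : ∀ {n} → (Fin n → ℕ) → ℕ
sumF {zero}  f = 0
sumF {suc n} f = f zero + sumF (λ i → f (suc i))

size : ∀ {n} → VSet n → ℕ
size X = count X

_⊂_ : ∀ {n} → VSet n → VSet n → Set
X ⊂ Y = (∀ v → X v ≡ true → Y v ≡ true) × (Σ _ λ v → (X v ≡ false) × (Y v ≡ true))

record CycleIn {n} (G : Graph n) (X : VSet n) : Set where
  field
    k      : ℕ
    vtx    : Fin (3 + k) → Fin n
    inj    : Injective _≡_ _≡_ vtx
    inX    : ∀ i → X (vtx i) ≡ true
    step   : ∀ (i : Fin (2 + k)) → G (vtx (inject₁ i)) (vtx (suc i)) ≡ true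
    close  : G (vtx (fromℕ (2 + k))) (vtx zero) ≡ true

IsForest : ∀ {n} → Graph n → VSet n → Set
IsForest G X = ¬ CycleIn G X

IsMaxForest : ∀ {n} → Graph n → VSet n → Set
IsMaxForest G X = IsForest G X × (∀ Y → X ⊂ Y → ¬ IsForest G Y)

IsForestNumber : ∀ {n} → Graph n → ℕ → Set
IsForestNumber G k = (Σ _ λ X → IsForest G X × size X ≡ k) × (∀ X → IsForest G X → size X ≤ k)

WellFCovered : ∀ {n} → Graph n → Set
WellFCovered G = ∀ X Y → IsMaxForest G X → IsMaxForest G Y → size X ≡ size Y

IsIndependent : ∀ {n} → Graph n → VSet n → Set
IsIndependent G X = ∀ u v → X u ≡ true → X v ≡ true → G u v ≡ false

IsMaxIndependent : ∀ {n} → Graph n → VSet n → Set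
IsMaxIndependent G X = IsIndependent G X × (∀ Y → X ⊂ Y → ¬ IsIndependent G Y)

IsIndepNumber : ∀ {n} → Graph n → ℕ → Set
IsIndepNumber G k = (Σ _ λ X → IsIndependent G X × size X ≡ k) × (∀ X → IsIndependent G X → size X ≤ k)

WellCovered : ∀ {n} → Graph n → Set
WellCovered G = ∀ X Y → IsMaxIndependent G X → IsMaxIndependent G Y → size X ≡ size Y

-- lexicographic product G ∘ H, vertex (g , h) encoded as combine g h ∈ Fin (n * m)
lex : ∀ {n m} → Graph n → Graph m → Graph (n * m)
lex {n} {m} G H x y with remQuot {n} m x | remQuot {n} m y
... | g , h | g' , h' = G g g' ∨ (⌊ g ≟ g' ⌋ ∧ H h h')

module _ {n} (G : Graph n) (X : VSet n) where
  degIn : Fin n → ℕ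
  degIn v = count (λ u → X u ∧ G v u)

  isolatedB : Fin n → Bool
  isolatedB v = X v ∧ (degIn v ≡ᵇ 0)

  leafB : Fin n → Bool
  leafB v = X v ∧ (degIn v ≡ᵇ 1)

  -- {u , v} spans a connected component of G[X] isomorphic to K₂:
  -- both in X, adjacent, and neither has another neighbour in X
  k2PairB : Fin n → Fin n → Bool
  k2PairB u v = leafB u ∧ leafB v ∧ X u ∧ X v ∧ G u v

  inK2B : Fin n → Bool
  inK2B v = anyB (λ u → k2PairB u v)

  Iso : ℕ
  Iso = count isolatedB

  -- K₂(F): components of F isomorphic to K₂ (unordered pairs counted once)
  K2 : ℕ
  K2 = sumF (λ v → count (λ u → (toℕ u <ᵇ toℕ v) ∧ k2PairB u v))

  Lf : ℕ
  Lf = count (λ v → leafB v ∧ not (inK2B v))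

  L' : ℕ
  L' = count (λ v → X v ∧ (1 <ᵇ degIn v))

-- For a maximal independent set I of G and a maximal forest T of H, the set I × T is a maximal
-- forest of G ∘ H with |I|·|T| vertices; comparing such forests gives that G is well-covered, that
-- H is well-f-covered and that f(G ∘ H) = α(G) f(H).
-- For part (4), a maximal forest F of G, a maximal independent set M and a maximal forest T of H give
-- a maximal forest of G ∘ H whose layer over g ∈ F is T if g is isolated in F, M if g is a leaf of F
-- (counting only one end of each K₂-component), and a single vertex h₀ ∈ M otherwise. Its size is
-- |T| I(F) + |M| (K₂(F) + L(F)) + K₂(F) + L'(F). Varying M shows that H is well-covered when F has a
-- leaf; when F has no isolated vertex and |M| = 1 the forest has exactly |F| vertices.
-- Constructively, a forest or independent set extends to a maximal one only under double negation;
-- this suffices because every conclusion is an equation between natural numbers.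

{-# OPTIONS --safe #-}
module Submission where

open import Defs
open import Data.Nat using (ℕ; zero; suc; _+_; _*_; _≤_; _<_; z≤n; s≤s; _≡ᵇ_; _<ᵇ_; >-nonZero)
open import Data.Nat.Properties
  using ( ≤-trans; ≤-reflexive; ≤-antisym; <-asym; <⇒≱; ≮⇒≥; ≤-pred; m≤n⇒m≤1+n; m≤n+m
        ; +-suc; +-monoˡ-≤; +-assoc; +-identityʳ; +-cancelˡ-≡; +-cancelʳ-≡
        ; *-comm; *-identityʳ; *-identityˡ; *-zeroʳ; *-distribˡ-+; *-cancelʳ-≡; *-cancelˡ-≡
        ; suc-injective; <-cmp; <ᵇ⇒<; <⇒<ᵇ; ≡ᵇ⇒≡ )
  renaming (_≟_ to _≟ℕ_)
open import Data.Nat.Tactic.RingSolver using (solve-∀)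
open import Data.Bool using (Bool; true; false; _∧_; _∨_; not; if_then_else_)
open import Data.Bool.Properties using (∨-comm; ∧-conicalˡ; ∧-conicalʳ; T-≡)
open import Data.Fin using (Fin; zero; suc; toℕ; inject₁; fromℕ; remQuot; combine; _↑ˡ_; _↑ʳ_; _≟_)
open import Data.Fin.Properties
  using (remQuot-combine; combine-remQuot; combine-injectiveˡ; combine-injectiveʳ; toℕ-inject₁; toℕ-injective)
  renaming (suc-injective to Fin-suc-injective)
open import Data.Product using (Σ; _×_; _,_; proj₁; proj₂)
open import Data.Sum using (_⊎_; inj₁; inj₂)
open import Data.Empty using (⊥; ⊥-elim)
open import Effect.Monad using (RawMonad)
open import Level using (0ℓ)
open import Function.Bundles using (Equivalence)
open import Function.Definitions using (Injective)
open import Relation.Binary.Definitions using (tri<; tri≈; tri>)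
open import Relation.Binary.PropositionalEquality
open import Relation.Nullary using (¬_; yes; no)
open import Relation.Nullary.Decidable using (⌊_⌋; decidable-stable; ¬¬-excluded-middle)
open import Relation.Nullary.Negation using (DoubleNegation; ¬¬-Monad)

private
  variable
    N : ℕ

∧-true⁻ : ∀ {a b} → a ∧ b ≡ true → (a ≡ true) × (b ≡ true)
∧-true⁻ {a} {b} e = ∧-conicalˡ a b e , ∧-conicalʳ a b e

∨-true⁻ : ∀ {a b} → a ∨ b ≡ true → (a ≡ true) ⊎ (b ≡ true)
∨-true⁻ {true}  _ = inj₁ refl
∨-true⁻ {false} e = inj₂ e

false⊎true : ∀ b → (b ≡ false) ⊎ (b ≡ true)
false⊎true false = inj₁ refl
false⊎true true  = inj₂ refl

true≢false : ¬ true ≡ false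
true≢false ()

implies-false : ∀ {a b} → (a ≡ true → b ≡ true) → b ≡ false → a ≡ false
implies-false {a} a⇒b ¬b with false⊎true a
... | inj₁ ¬a = ¬a
... | inj₂ a  = ⊥-elim (true≢false (trans (sym (a⇒b a)) ¬b))

exclusive-sym : ∀ {a b} → (a ≡ true → b ≡ false) → b ≡ true → a ≡ false
exclusive-sym {a} a⇒¬b b with false⊎true a
... | inj₁ ¬a = ¬a
... | inj₂ a  = ⊥-elim (true≢false (trans (sym b) (a⇒¬b a)))

⌊≟⌋-true⁻ : ∀ {u v : Fin N} → ⌊ u ≟ v ⌋ ≡ true → u ≡ v
⌊≟⌋-true⁻ {u = u} {v} e with u ≟ v
... | yes u≡v = u≡v

⌊≟⌋-refl : ∀ (u : Fin N) → ⌊ u ≟ u ⌋ ≡ true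
⌊≟⌋-refl u with u ≟ u
... | yes _  = refl
... | no u≢u = ⊥-elim (u≢u refl)

⌊≟⌋-false : ∀ {u v : Fin N} → ¬ u ≡ v → ⌊ u ≟ v ⌋ ≡ false
⌊≟⌋-false {u = u} {v} u≢v with u ≟ v
... | yes u≡v = ⊥-elim (u≢v u≡v)
... | no _    = refl

<ᵇ-true⁻ : ∀ {a b} → (a <ᵇ b) ≡ true → a < b
<ᵇ-true⁻ {a} {b} e = <ᵇ⇒< a b (Equivalence.from T-≡ e)

<ᵇ-true : ∀ {a b} → a < b → (a <ᵇ b) ≡ true
<ᵇ-true a<b = Equivalence.to T-≡ (<⇒<ᵇ a<b)

≡ᵇ-true⁻ : ∀ {a b} → (a ≡ᵇ b) ≡ true → a ≡ b
≡ᵇ-true⁻ {a} {b} e = ≡ᵇ⇒≡ a b (Equivalence.from T-≡ e)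

-- Counting

ind : Bool → ℕ
ind b = if b then 1 else 0

count≡sumF : (p : Fin N → Bool) → count p ≡ sumF (λ i → ind (p i))
count≡sumF {zero}  p = refl
count≡sumF {suc N} p = cong (ind (p zero) +_) (count≡sumF (λ i → p (suc i)))

sumF-cong : {f g : Fin N → ℕ} → (∀ i → f i ≡ g i) → sumF f ≡ sumF g
sumF-cong {zero}  e = refl
sumF-cong {suc N} e = cong₂ _+_ (e zero) (sumF-cong (λ i → e (suc i)))

count-cong : {p q : Fin N → Bool} → (∀ i → p i ≡ q i) → count p ≡ count q
count-cong {zero}  e = refl
count-cong {suc N} e = cong₂ _+_ (cong ind (e zero)) (count-cong (λ i → e (suc i)))

sumF-+ : (f g : Fin N → ℕ) → sumF (λ i → f i + g i) ≡ sumF f + sumF g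
sumF-+ {zero}  f g = refl
sumF-+ {suc N} f g rewrite sumF-+ (λ i → f (suc i)) (λ i → g (suc i)) =
  interchange (f zero) (g zero) (sumF (λ i → f (suc i))) (sumF (λ i → g (suc i)))
  where
  interchange : ∀ a b c d → a + b + (c + d) ≡ a + c + (b + d)
  interchange = solve-∀

sumF-* : ∀ a (f : Fin N → ℕ) → sumF (λ i → a * f i) ≡ a * sumF f
sumF-* {zero}  a f = sym (*-zeroʳ a)
sumF-* {suc N} a f rewrite sumF-* a (λ i → f (suc i)) = sym (*-distribˡ-+ a (f zero) _)

sumF-zero : sumF {N} (λ _ → 0) ≡ 0
sumF-zero {zero}  = refl
sumF-zero {suc N} = sumF-zero {N}

count-false : count {N} (λ _ → false) ≡ 0
count-false {zero}  = refl
count-false {suc N} = count-false {N}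

count≤ : (p : Fin N → Bool) → count p ≤ N
count≤ {zero}  p = z≤n
count≤ {suc N} p with p zero
... | true  = s≤s (count≤ (λ i → p (suc i)))
... | false = m≤n⇒m≤1+n (count≤ (λ i → p (suc i)))

count-mono : (p q : Fin N → Bool) → (∀ i → p i ≡ true → q i ≡ true) → count p ≤ count q
count-mono {zero}  p q p⇒q = z≤n
count-mono {suc N} p q p⇒q with p zero in pz | q zero in qz
... | true  | true  = s≤s (count-mono _ _ (λ i → p⇒q (suc i)))
... | true  | false = ⊥-elim (true≢false (trans (sym (p⇒q zero pz)) qz))
... | false | true  = m≤n⇒m≤1+n (count-mono _ _ (λ i → p⇒q (suc i)))
... | false | false = count-mono _ _ (λ i → p⇒q (suc i))

count-strictMono : (p q : Fin N → Bool) → (∀ i → p i ≡ true → q i ≡ true)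
                 → ∀ v → p v ≡ false → q v ≡ true → count p < count q
count-strictMono {suc N} p q p⇒q zero pv qv rewrite pv | qv = s≤s (count-mono _ _ (λ i → p⇒q (suc i)))
count-strictMono {suc N} p q p⇒q (suc v) pv qv with p zero in pz | q zero in qz
... | true  | true  = s≤s (count-strictMono _ _ (λ i → p⇒q (suc i)) v pv qv)
... | true  | false = ⊥-elim (true≢false (trans (sym (p⇒q zero pz)) qz))
... | false | true  = m≤n⇒m≤1+n (count-strictMono _ _ (λ i → p⇒q (suc i)) v pv qv)
... | false | false = count-strictMono _ _ (λ i → p⇒q (suc i)) v pv qv

count-pos : (p : Fin N → Bool) → ∀ v → p v ≡ true → 1 ≤ count p
count-pos {N} p v pv = subst (_< count p) (count-false {N}) (count-strictMono (λ _ → false) p (λ _ ()) v refl pv)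

count-pos⁻ : (p : Fin N → Bool) → 1 ≤ count p → Σ (Fin N) λ v → p v ≡ true
count-pos⁻ {suc N} p pos with p zero in pz
... | true  = zero , pz
... | false with count-pos⁻ (λ i → p (suc i)) pos
...   | v , pv = suc v , pv

count-zero⁻ : (p : Fin N → Bool) → count p ≡ 0 → ∀ v → p v ≡ false
count-zero⁻ p c≡0 v with p v in pv
... | false = refl
... | true  with () ← ≤-trans (count-pos p v pv) (≤-reflexive c≡0)

count≥2⁻ : (p : Fin N → Bool) → 2 ≤ count p
         → Σ (Fin N) λ a → Σ (Fin N) λ b → (¬ a ≡ b) × (p a ≡ true) × (p b ≡ true)
count≥2⁻ {suc N} p two with p zero in pz
... | true with count-pos⁻ (λ i → p (suc i)) (≤-pred two)
...   | v , pv = zero , suc v , (λ ()) , pz , pv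
count≥2⁻ {suc N} p two | false with count≥2⁻ (λ i → p (suc i)) two
...   | a , b , a≢b , pa , pb = suc a , suc b , (λ e → a≢b (Fin-suc-injective e)) , pa , pb

count≡1⁻ : (p : Fin N → Bool) → count p ≡ 1 → ∀ a b → p a ≡ true → p b ≡ true → a ≡ b
count≡1⁻ {suc N} p one zero    zero    pa pb = refl
count≡1⁻ {suc N} p one zero    (suc b) pa pb rewrite pa
  with () ← ≤-trans (count-pos _ b pb) (≤-reflexive (suc-injective one))
count≡1⁻ {suc N} p one (suc a) zero    pa pb rewrite pb
  with () ← ≤-trans (count-pos _ a pa) (≤-reflexive (suc-injective one))
count≡1⁻ {suc N} p one (suc a) (suc b) pa pb with p zero
... | true  with () ← ≤-trans (count-pos _ a pa) (≤-reflexive (suc-injective one))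
... | false = cong suc (count≡1⁻ _ one a b pa pb)

anyB⁻ : (p : Fin N → Bool) → anyB p ≡ true → Σ (Fin N) λ i → p i ≡ true
anyB⁻ {suc N} p any with p zero in pz
... | true  = zero , pz
... | false with anyB⁻ (λ i → p (suc i)) any
...   | i , pi = suc i , pi

anyB-intro : (p : Fin N → Bool) → ∀ i → p i ≡ true → anyB p ≡ true
anyB-intro p zero    pi rewrite pi = refl
anyB-intro p (suc i) pi with p zero
... | true  = refl
... | false = anyB-intro (λ i → p (suc i)) i pi

anyB-false⁻ : (p : Fin N → Bool) → anyB p ≡ false → ∀ i → p i ≡ false
anyB-false⁻ p none i with p i in pi
... | false = refl
... | true  = trans (sym (anyB-intro p i pi)) none

ind-anyB≡count : (p : Fin N → Bool) → (∀ a b → p a ≡ true → p b ≡ true → a ≡ b) → ind (anyB p) ≡ count p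
ind-anyB≡count {N} p unique with anyB p in any
... | false = sym (trans (count-cong (anyB-false⁻ p any)) (count-false {N}))
... | true with anyB⁻ p any
...   | i , pi = ≤-antisym (count-pos p i pi) (≮⇒≥ λ two → noTwo (count≥2⁻ p two))
  where
  noTwo : ¬ (Σ _ λ a → Σ _ λ b → (¬ a ≡ b) × (p a ≡ true) × (p b ≡ true))
  noTwo (a , b , a≢b , pa , pb) = a≢b (unique a b pa pb)

ind-∨-disjoint : ∀ a b → (b ≡ true → a ≡ false) → ind (a ∨ b) ≡ ind a + ind b
ind-∨-disjoint false b     _    = refl
ind-∨-disjoint true  false _    = refl
ind-∨-disjoint true  true  b⇒¬a with () ← b⇒¬a refl

ind-∨-complement : ∀ f a b → (a ≡ true → f ≡ true) → (b ≡ true → f ≡ true)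
                 → ind f ≡ ind (a ∨ b) + ind (f ∧ not a ∧ not b)
ind-∨-complement true  false false _   _   = refl
ind-∨-complement true  false true  _   _   = refl
ind-∨-complement true  true  b     _   _   = refl
ind-∨-complement false false false _   _   = refl
ind-∨-complement false true  b     a⇒f _   with () ← a⇒f refl
ind-∨-complement false false true  _   b⇒f with () ← b⇒f refl

count-split : (p q r : Fin N → Bool) → (∀ i → ind (p i) ≡ ind (q i) + ind (r i)) → count p ≡ count q + count r
count-split p q r split = begin
  count p                                           ≡⟨ count≡sumF p ⟩
  sumF (λ i → ind (p i))                            ≡⟨ sumF-cong split ⟩
  sumF (λ i → ind (q i) + ind (r i))                ≡⟨ sumF-+ (λ i → ind (q i)) (λ i → ind (r i)) ⟩
  sumF (λ i → ind (q i)) + sumF (λ i → ind (r i))   ≡⟨ sym (cong₂ _+_ (count≡sumF q) (count≡sumF r)) ⟩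
  count q + count r                                 ∎
  where open ≡-Reasoning

count-singleton : (v : Fin N) → count (λ u → ⌊ u ≟ v ⌋) ≡ 1
count-singleton {N} v = trans (sym (ind-anyB≡count (λ u → ⌊ u ≟ v ⌋) (λ a b ea eb → trans (⌊≟⌋-true⁻ ea) (sym (⌊≟⌋-true⁻ eb)))))
                          (cong ind (anyB-intro _ v (⌊≟⌋-refl v)))

sumF-count-swap : ∀ {n m} (P : Fin n → Fin m → Bool)
                → sumF (λ i → count (λ j → P i j)) ≡ sumF (λ j → count (λ i → P i j))
sumF-count-swap {zero}  {m} P = sym (sumF-zero {m})
sumF-count-swap {suc n} {m} P = begin
    count (P zero) + sumF (λ i → count (λ j → P (suc i) j))
  ≡⟨ cong₂ _+_ (count≡sumF (P zero)) (sumF-count-swap (λ i j → P (suc i) j)) ⟩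
    sumF (λ j → ind (P zero j)) + sumF (λ j → count (λ i → P (suc i) j))
  ≡⟨ sym (sumF-+ {m} _ _) ⟩
    sumF (λ j → ind (P zero j) + count (λ i → P (suc i) j))
  ∎
  where open ≡-Reasoning

count-++ : ∀ a b (p : Fin (a + b) → Bool)
         → count p ≡ count {a} (λ i → p (i ↑ˡ b)) + count {b} (λ j → p (a ↑ʳ j))
count-++ zero    b p = refl
count-++ (suc a) b p rewrite count-++ a b (λ i → p (suc i)) = sym (+-assoc (ind (p zero)) _ _)

count-remQuot : ∀ n m (p : Fin n → Fin m → Bool)
              → count {n * m} (λ x → p (proj₁ (remQuot {n} m x)) (proj₂ (remQuot {n} m x)))
                ≡ sumF (λ g → count (p g))
count-remQuot zero    m p = refl
count-remQuot (suc n) m p = begin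
    count {m + n * m} (λ x → p′ (remQuot {suc n} m x))
  ≡⟨ count-++ m (n * m) _ ⟩
    count {m} (λ i → p′ (remQuot {suc n} m (i ↑ˡ (n * m))))
      + count {n * m} (λ j → p′ (remQuot {suc n} m (m ↑ʳ j)))
  ≡⟨ cong₂ _+_ (count-cong (λ i → cong p′ (remQuot-combine {suc n} {m} zero i))) (count-cong shift) ⟩
    count {m} (p zero) + count {n * m} (λ j → p′ (suc (proj₁ (remQuot {n} m j)) , proj₂ (remQuot {n} m j)))
  ≡⟨ cong (count (p zero) +_) (count-remQuot n m (λ g → p (suc g))) ⟩
    sumF (λ g → count (p g))
  ∎
  where
  open ≡-Reasoning
  p′ : Fin (suc n) × Fin m → Bool
  p′ (g , h) = p g h
  shift : ∀ j → p′ (remQuot {suc n} m (m ↑ʳ j)) ≡ p′ (suc (proj₁ (remQuot {n} m j)) , proj₂ (remQuot {n} m j))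
  shift j = cong p′ (trans (cong (λ z → remQuot {suc n} m (m ↑ʳ z)) (sym (combine-remQuot {n} m j)))
                           (remQuot-combine {suc n} {m} (suc (proj₁ (remQuot {n} m j))) (proj₂ (remQuot {n} m j))))

-- Vertex sets and maximal extensions

_⊆_ : VSet N → VSet N → Set
X ⊆ Y = ∀ v → X v ≡ true → Y v ≡ true

∅ : VSet N
∅ _ = false

insert : VSet N → Fin N → VSet N
insert X v u = X u ∨ ⌊ u ≟ v ⌋

insert-new : (X : VSet N) → ∀ v → insert X v v ≡ true
insert-new X v = trans (cong (X v ∨_) (⌊≟⌋-refl v)) (∨-comm (X v) true)

insert-old : (X : VSet N) → ∀ v u → X u ≡ true → insert X v u ≡ true
insert-old X v u Xu rewrite Xu = refl

insert⁻ : (X : VSet N) → ∀ v u → insert X v u ≡ true → (X u ≡ true) ⊎ (u ≡ v)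
insert⁻ X v u e with ∨-true⁻ {X u} e
... | inj₁ Xu = inj₁ Xu
... | inj₂ u≟v = inj₂ (⌊≟⌋-true⁻ u≟v)

⊂-insert : (X : VSet N) → ∀ v → X v ≡ false → X ⊂ insert X v
⊂-insert X v Xv = insert-old X v , v , Xv , insert-new X v

⊂⇒size< : {X Y : VSet N} → X ⊂ Y → size X < size Y
⊂⇒size< {X = X} {Y} (X⊆Y , v , Xv , Yv) = count-strictMono X Y X⊆Y v Xv Yv

≡-stable : ∀ {a b : ℕ} → DoubleNegation (a ≡ b) → a ≡ b
≡-stable {a} {b} = decidable-stable (a ≟ℕ b)

module _ (P : VSet N → Set) where

  IsMaximal : VSet N → Set
  IsMaximal Y = P Y × (∀ Z → Y ⊂ Z → ¬ P Z)

  open RawMonad (¬¬-Monad {a = 0ℓ})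

  -- d bounds the number of vertices that can still be added to X.
  extendToMaximal′ : ∀ d X → N ≤ size X + d → P X → DoubleNegation (Σ _ λ Y → IsMaximal Y × X ⊆ Y)
  extendToMaximal′ zero X full PX = pure (X , (PX , noGrowth) , λ _ Xv → Xv)
    where
    noGrowth : ∀ Z → X ⊂ Z → ¬ P Z
    noGrowth Z X⊂Z _ = <⇒≱ (⊂⇒size< X⊂Z) (≤-trans (count≤ Z) (≤-trans full (≤-reflexive (+-identityʳ _))))
  extendToMaximal′ (suc d) X bound PX = ¬¬-excluded-middle >>= λ where
      (yes maximal) → pure (X , (PX , maximal) , λ _ Xv → Xv)
      (no ¬maximal) → do
        Z , X⊂Z , PZ ← (λ k → ¬maximal (λ Z X⊂Z PZ → k (Z , X⊂Z , PZ)))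
        Y , maxY , Z⊆Y ← extendToMaximal′ d Z (bound′ X⊂Z) PZ
        pure (Y , maxY , λ v Xv → Z⊆Y v (proj₁ X⊂Z v Xv))
    where
    bound′ : ∀ {Z} → X ⊂ Z → N ≤ size Z + d
    bound′ X⊂Z = ≤-trans bound (≤-trans (≤-reflexive (+-suc (size X) d)) (+-monoˡ-≤ d (⊂⇒size< X⊂Z)))

  extendToMaximal : ∀ X → P X → DoubleNegation (Σ _ λ Y → IsMaximal Y × X ⊆ Y)
  extendToMaximal X = extendToMaximal′ N X (m≤n+m N (size X))

-- Cycles

Symmetric : Graph N → Set
Symmetric K = ∀ u v → K u v ≡ K v u

inject₁-induction : ∀ {M} (Q : Fin (suc M) → Set) → Q zero → (∀ (i : Fin M) → Q (inject₁ i) → Q (suc i)) → ∀ i → Q i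
inject₁-induction Q base step zero = base
inject₁-induction {suc M} Q base step (suc i) =
  inject₁-induction (λ j → Q (suc j)) (step zero base) (λ i → step (suc i)) i

last-or-inject₁ : (i : Fin (suc N)) → (i ≡ fromℕ N) ⊎ (Σ (Fin N) λ j → i ≡ inject₁ j)
last-or-inject₁ {zero}  zero    = inj₁ refl
last-or-inject₁ {suc N} zero    = inj₂ (zero , refl)
last-or-inject₁ {suc N} (suc i) with last-or-inject₁ i
... | inj₁ e       = inj₁ (cong suc e)
... | inj₂ (j , e) = inj₂ (suc j , cong suc e)

module _ {K : Graph N} {X : VSet N} (c : CycleIn K X) where
  open CycleIn c

  cycle-neighbours : Symmetric K → ∀ j → Σ _ λ p → Σ _ λ s → (¬ p ≡ s) × (K (vtx j) (vtx p) ≡ true) × (K (vtx j) (vtx s) ≡ true)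
  cycle-neighbours K-sym zero = suc zero , fromℕ (2 + k) , (λ ()) , step zero , trans (K-sym _ _) close
  cycle-neighbours K-sym (suc j) with last-or-inject₁ j
  ... | inj₁ refl        = inject₁ j , zero , (λ ()) , trans (K-sym _ _) (step j) , close
  ... | inj₂ (j′ , refl) = inject₁ j , suc (suc j′) , distinct , trans (K-sym _ _) (step j) , step (suc j′)
    where
    n≢2+n : ∀ n → ¬ n ≡ suc (suc n)
    n≢2+n zero    ()
    n≢2+n (suc n) e = n≢2+n n (suc-injective e)
    distinct : ¬ inject₁ (inject₁ j′) ≡ suc (suc j′)
    distinct e = n≢2+n (toℕ j′) (trans (sym (trans (toℕ-inject₁ (inject₁ j′)) (toℕ-inject₁ j′))) (cong toℕ e))

  map-cycle : ∀ {N′} (K′ : Graph N′) (X′ : VSet N′) (w : Fin N → Fin N′)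
            → (∀ i j → w (vtx i) ≡ w (vtx j) → vtx i ≡ vtx j) → (∀ i → X′ (w (vtx i)) ≡ true)
            → (∀ i j → K (vtx i) (vtx j) ≡ true → K′ (w (vtx i)) (w (vtx j)) ≡ true) → CycleIn K′ X′
  map-cycle K′ X′ w w-inj w-in w-adj = record
    { k = k ; vtx = λ i → w (vtx i) ; inj = λ {i} {j} e → inj (w-inj i j e) ; inX = w-in
    ; step = λ i → w-adj _ _ (step i) ; close = w-adj _ _ close }

triangle : (K : Graph N) (X : VSet N) (a b c : Fin N) → ¬ a ≡ b → ¬ b ≡ c → ¬ a ≡ c
         → K a b ≡ true → K b c ≡ true → K c a ≡ true → X a ≡ true → X b ≡ true → X c ≡ true → CycleIn K X
triangle K X a b c a≢b b≢c a≢c ab bc ca Xa Xb Xc = record { k = 0 ; vtx = v ; inj = v-inj ; inX = v-in ; step = v-step ; close = ca }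
  where
  v : Fin 3 → _
  v zero             = a
  v (suc zero)       = b
  v (suc (suc zero)) = c
  v-inj : Injective _≡_ _≡_ v
  v-inj {zero}             {zero}             e = refl
  v-inj {zero}             {suc zero}         e = ⊥-elim (a≢b e)
  v-inj {zero}             {suc (suc zero)}   e = ⊥-elim (a≢c e)
  v-inj {suc zero}         {zero}             e = ⊥-elim (a≢b (sym e))
  v-inj {suc zero}         {suc zero}         e = refl
  v-inj {suc zero}         {suc (suc zero)}   e = ⊥-elim (b≢c e)
  v-inj {suc (suc zero)}   {zero}             e = ⊥-elim (a≢c (sym e))
  v-inj {suc (suc zero)}   {suc zero}         e = ⊥-elim (b≢c (sym e))
  v-inj {suc (suc zero)}   {suc (suc zero)}   e = refl
  v-in : ∀ i → X (v i) ≡ true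
  v-in zero             = Xa
  v-in (suc zero)       = Xb
  v-in (suc (suc zero)) = Xc
  v-step : ∀ (i : Fin 2) → K (v (inject₁ i)) (v (suc i)) ≡ true
  v-step zero       = ab
  v-step (suc zero) = bc

square : (K : Graph N) (X : VSet N) (a b c d : Fin N)
       → ¬ a ≡ b → ¬ a ≡ c → ¬ a ≡ d → ¬ b ≡ c → ¬ b ≡ d → ¬ c ≡ d
       → K a b ≡ true → K b c ≡ true → K c d ≡ true → K d a ≡ true
       → X a ≡ true → X b ≡ true → X c ≡ true → X d ≡ true → CycleIn K X
square K X a b c d a≢b a≢c a≢d b≢c b≢d c≢d ab bc cd da Xa Xb Xc Xd =
  record { k = 1 ; vtx = v ; inj = v-inj ; inX = v-in ; step = v-step ; close = da }
  where
  v : Fin 4 → _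
  v zero                   = a
  v (suc zero)             = b
  v (suc (suc zero))       = c
  v (suc (suc (suc zero))) = d
  v-inj : Injective _≡_ _≡_ v
  v-inj {zero}                   {zero}                   e = refl
  v-inj {zero}                   {suc zero}               e = ⊥-elim (a≢b e)
  v-inj {zero}                   {suc (suc zero)}         e = ⊥-elim (a≢c e)
  v-inj {zero}                   {suc (suc (suc zero))}   e = ⊥-elim (a≢d e)
  v-inj {suc zero}               {zero}                   e = ⊥-elim (a≢b (sym e))
  v-inj {suc zero}               {suc zero}               e = refl
  v-inj {suc zero}               {suc (suc zero)}         e = ⊥-elim (b≢c e)
  v-inj {suc zero}               {suc (suc (suc zero))}   e = ⊥-elim (b≢d e)
  v-inj {suc (suc zero)}         {zero}                   e = ⊥-elim (a≢c (sym e))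
  v-inj {suc (suc zero)}         {suc zero}               e = ⊥-elim (b≢c (sym e))
  v-inj {suc (suc zero)}         {suc (suc zero)}         e = refl
  v-inj {suc (suc zero)}         {suc (suc (suc zero))}   e = ⊥-elim (c≢d e)
  v-inj {suc (suc (suc zero))}   {zero}                   e = ⊥-elim (a≢d (sym e))
  v-inj {suc (suc (suc zero))}   {suc zero}               e = ⊥-elim (b≢d (sym e))
  v-inj {suc (suc (suc zero))}   {suc (suc zero)}         e = ⊥-elim (c≢d (sym e))
  v-inj {suc (suc (suc zero))}   {suc (suc (suc zero))}   e = refl
  v-in : ∀ i → X (v i) ≡ true
  v-in zero                   = Xa
  v-in (suc zero)             = Xb
  v-in (suc (suc zero))       = Xc
  v-in (suc (suc (suc zero))) = Xd
  v-step : ∀ (i : Fin 3) → K (v (inject₁ i)) (v (suc i)) ≡ true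
  v-step zero             = ab
  v-step (suc zero)       = bc
  v-step (suc (suc zero)) = cd

-- Independent sets and forests

∅-isForest : (K : Graph N) → IsForest K ∅
∅-isForest K c with CycleIn.inX c zero
... | ()

∅-isIndependent : (K : Graph N) → IsIndependent K ∅
∅-isIndependent K u v ()

adjacent⇒≢ : {K : Graph N} → IsSimple K → ∀ {u v} → K u v ≡ true → ¬ u ≡ v
adjacent⇒≢ (_ , loopless) {u} uv refl = true≢false (trans (sym uv) (loopless u))

maxIndependent-dominating : {K : Graph N} → IsSimple K → ∀ {M} → IsMaxIndependent K M
                          → ∀ h → M h ≡ false → Σ _ λ x → (M x ≡ true) × (K h x ≡ true)
maxIndependent-dominating {K = K} (K-sym , loopless) {M} (independent , maximal) h Mh
  with anyB (λ x → M x ∧ K h x) in some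
... | true with anyB⁻ _ some
...   | x , Mx∧hx = x , ∧-true⁻ Mx∧hx
maxIndependent-dominating {K = K} (K-sym , loopless) {M} (independent , maximal) h Mh | false =
  ⊥-elim (maximal (insert M h) (⊂-insert M h Mh) independent′)
  where
  noNeighbour : ∀ x → M x ≡ true → K h x ≡ false
  noNeighbour x Mx = subst (_≡ false) (cong (_∧ K h x) Mx) (anyB-false⁻ _ some x)
  independent′ : IsIndependent K (insert M h)
  independent′ u v Mu Mv with insert⁻ M h u Mu | insert⁻ M h v Mv
  ... | inj₁ Mu′ | inj₁ Mv′ = independent u v Mu′ Mv′
  ... | inj₁ Mu′ | inj₂ refl = trans (K-sym u v) (noNeighbour u Mu′)
  ... | inj₂ refl | inj₁ Mv′ = noNeighbour v Mv′
  ... | inj₂ refl | inj₂ refl = loopless u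

maxIndependent-nonempty : {K : Graph N} → IsSimple K → ∀ {M} → IsMaxIndependent K M
                        → Fin N → Σ _ λ x → M x ≡ true
maxIndependent-nonempty {K = K} simple {M} maxM v with anyB M in some
... | true  = anyB⁻ M some
... | false with maxIndependent-dominating simple maxM v (anyB-false⁻ M some v)
...   | x , Mx , _ = ⊥-elim (true≢false (trans (sym Mx) (anyB-false⁻ M some x)))

-- A vertex of a cycle other than u would have both cycle-neighbours equal to u.
independent+vertex-isForest : {K : Graph N} → Symmetric K → ∀ {I} → IsIndependent K I → ∀ u → IsForest K (insert I u)
independent+vertex-isForest {K = K} K-sym {I} independent u c = notU (proj₂ someNotU)
  where
  open CycleIn c
  someNotU : Σ _ λ j → ¬ vtx j ≡ u
  someNotU with vtx zero ≟ u
  ... | no v₀≢u = zero , v₀≢u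
  ... | yes v₀≡u with vtx (suc zero) ≟ u
  ...   | no v₁≢u = suc zero , v₁≢u
  ...   | yes v₁≡u with () ← inj (trans v₀≡u (sym v₁≡u))
  neighbour≡u : ∀ j p → ¬ vtx j ≡ u → K (vtx j) (vtx p) ≡ true → vtx p ≡ u
  neighbour≡u j p j≢u jp with insert⁻ I u (vtx j) (inX j) | insert⁻ I u (vtx p) (inX p)
  ... | inj₂ j≡u | _        = ⊥-elim (j≢u j≡u)
  ... | inj₁ _   | inj₂ p≡u = p≡u
  ... | inj₁ Ij  | inj₁ Ip  = ⊥-elim (true≢false (trans (sym jp) (independent _ _ Ij Ip)))
  notU : ∀ {j} → ¬ vtx j ≡ u → ⊥
  notU {j} j≢u with cycle-neighbours c K-sym j
  ... | p , s , p≢s , jp , js = p≢s (inj (trans (neighbour≡u j p j≢u jp) (sym (neighbour≡u j s j≢u js))))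

maxForest-hasEdge : {K : Graph N} → Symmetric K → ∀ {T} → IsMaxForest K T → HasEdge K
                  → Σ _ λ a → Σ _ λ b → (T a ≡ true) × (T b ≡ true) × (K a b ≡ true)
maxForest-hasEdge {K = K} K-sym {T} (forest , maximal) (u , v , uv)
  with anyB (λ a → anyB (λ b → T a ∧ T b ∧ K a b)) in some
... | true with anyB⁻ _ some
...   | a , some′ with anyB⁻ _ some′
...     | b , Ta∧Tb∧ab with ∧-true⁻ Ta∧Tb∧ab
...       | Ta , Tb∧ab = a , b , Ta , ∧-true⁻ Tb∧ab
maxForest-hasEdge {K = K} K-sym {T} (forest , maximal) (u , v , uv) | false =
  ⊥-elim (true≢false (trans (sym uv) (independent u v (everything u) (everything v))))
  where
  independent : IsIndependent K T
  independent a b Ta Tb = subst (_≡ false) (cong₂ (λ x y → x ∧ y ∧ K a b) Ta Tb)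
                                (anyB-false⁻ _ (anyB-false⁻ _ some a) b)
  everything : ∀ w → T w ≡ true
  everything w with T w in Tw
  ... | true  = refl
  ... | false = ⊥-elim (maximal (insert T w) (⊂-insert T w Tw) (independent+vertex-isForest K-sym independent w))

-- The lexicographic product

module LexProduct {n m} {G : Graph n} {H : Graph m} (simpleG : IsSimple G) (simpleH : IsSimple H) where

  L : Graph (n * m)
  L = lex G H

  π₁ : Fin (n * m) → Fin n
  π₁ x = proj₁ (remQuot {n} m x)

  π₂ : Fin (n * m) → Fin m
  π₂ x = proj₂ (remQuot {n} m x)

  ⟨_,_⟩ : Fin n → Fin m → Fin (n * m)
  ⟨_,_⟩ = combine {n} {m}

  π₁-⟨⟩ : ∀ g h → π₁ ⟨ g , h ⟩ ≡ g
  π₁-⟨⟩ g h = cong proj₁ (remQuot-combine {n} {m} g h)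

  π₂-⟨⟩ : ∀ g h → π₂ ⟨ g , h ⟩ ≡ h
  π₂-⟨⟩ g h = cong proj₂ (remQuot-combine {n} {m} g h)

  ⟨π₁,π₂⟩ : ∀ x → ⟨ π₁ x , π₂ x ⟩ ≡ x
  ⟨π₁,π₂⟩ x = combine-remQuot {n} m x

  π-injective : ∀ {x y} → π₁ x ≡ π₁ y → π₂ x ≡ π₂ y → x ≡ y
  π-injective {x} {y} e₁ e₂ = trans (sym (⟨π₁,π₂⟩ x)) (trans (cong₂ ⟨_,_⟩ e₁ e₂) (⟨π₁,π₂⟩ y))

  ⟨⟩-≢₁ : ∀ {g g′ h h′} → ¬ g ≡ g′ → ¬ ⟨ g , h ⟩ ≡ ⟨ g′ , h′ ⟩
  ⟨⟩-≢₁ {g} {g′} {h} {h′} g≢g′ e = g≢g′ (trans (sym (π₁-⟨⟩ g h)) (trans (cong π₁ e) (π₁-⟨⟩ g′ h′)))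

  ⟨⟩-≢₂ : ∀ {g g′ h h′} → ¬ h ≡ h′ → ¬ ⟨ g , h ⟩ ≡ ⟨ g′ , h′ ⟩
  ⟨⟩-≢₂ {g} {g′} {h} {h′} h≢h′ e = h≢h′ (trans (sym (π₂-⟨⟩ g h)) (trans (cong π₂ e) (π₂-⟨⟩ g′ h′)))

  L-def : ∀ x y → L x y ≡ G (π₁ x) (π₁ y) ∨ (⌊ π₁ x ≟ π₁ y ⌋ ∧ H (π₂ x) (π₂ y))
  L-def x y with remQuot {n} m x | remQuot {n} m y
  ... | _ | _ = refl

  L-adjacent⁻ : ∀ x y → L x y ≡ true → (G (π₁ x) (π₁ y) ≡ true) ⊎ ((π₁ x ≡ π₁ y) × (H (π₂ x) (π₂ y) ≡ true))
  L-adjacent⁻ x y xy rewrite L-def x y with G (π₁ x) (π₁ y) | π₁ x ≟ π₁ y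
  ... | true  | _         = inj₁ refl
  ... | false | yes x₁≡y₁ = inj₂ (x₁≡y₁ , xy)

  L-adjacentᴳ : ∀ x y → G (π₁ x) (π₁ y) ≡ true → L x y ≡ true
  L-adjacentᴳ x y xy rewrite L-def x y | xy = refl

  L-adjacentᴴ : ∀ x y → π₁ x ≡ π₁ y → H (π₂ x) (π₂ y) ≡ true → L x y ≡ true
  L-adjacentᴴ x y x₁≡y₁ xy rewrite L-def x y | xy | x₁≡y₁ | ⌊≟⌋-refl (π₁ y) = ∨-comm _ true

  ⟨⟩-adjacentᴳ : ∀ {g g′} h h′ → G g g′ ≡ true → L ⟨ g , h ⟩ ⟨ g′ , h′ ⟩ ≡ true
  ⟨⟩-adjacentᴳ {g} {g′} h h′ gg′ =
    L-adjacentᴳ _ _ (subst₂ (λ a b → G a b ≡ true) (sym (π₁-⟨⟩ g h)) (sym (π₁-⟨⟩ g′ h′)) gg′)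

  ⟨⟩-adjacentᴴ : ∀ g {h h′} → H h h′ ≡ true → L ⟨ g , h ⟩ ⟨ g , h′ ⟩ ≡ true
  ⟨⟩-adjacentᴴ g {h} {h′} hh′ = L-adjacentᴴ _ _ (trans (π₁-⟨⟩ g h) (sym (π₁-⟨⟩ g h′)))
    (subst₂ (λ a b → H a b ≡ true) (sym (π₂-⟨⟩ g h)) (sym (π₂-⟨⟩ g h′)) hh′)

  L-sameLayer⇒H : ∀ x y → π₁ x ≡ π₁ y → L x y ≡ true → H (π₂ x) (π₂ y) ≡ true
  L-sameLayer⇒H x y x₁≡y₁ xy with L-adjacent⁻ x y xy
  ... | inj₁ Gxy      = ⊥-elim (adjacent⇒≢ simpleG Gxy x₁≡y₁)
  ... | inj₂ (_ , Hxy) = Hxy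

  L-simple : IsSimple L
  L-simple = L-symmetric , L-loopless
    where
    L-symmetric : Symmetric L
    L-symmetric x y with L x y in xy | L y x in yx
    ... | true  | true  = refl
    ... | false | false = refl
    ... | true  | false with L-adjacent⁻ x y xy
    ...   | inj₁ Gxy         = trans (sym (L-adjacentᴳ y x (trans (proj₁ simpleG _ _) Gxy))) yx
    ...   | inj₂ (x₁≡y₁ , Hxy) = trans (sym (L-adjacentᴴ y x (sym x₁≡y₁) (trans (proj₁ simpleH _ _) Hxy))) yx
    L-symmetric x y | false | true with L-adjacent⁻ y x yx
    ...   | inj₁ Gyx         = trans (sym xy) (L-adjacentᴳ x y (trans (proj₁ simpleG _ _) Gyx))
    ...   | inj₂ (y₁≡x₁ , Hyx) = trans (sym xy) (L-adjacentᴴ x y (sym y₁≡x₁) (trans (proj₁ simpleH _ _) Hyx))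
    L-loopless : ∀ x → L x x ≡ false
    L-loopless x with L x x in xx
    ... | false = refl
    ... | true with L-adjacent⁻ x x xx
    ...   | inj₁ Gxx       = trans (sym Gxx) (proj₂ simpleG (π₁ x))
    ...   | inj₂ (_ , Hxx) = trans (sym Hxx) (proj₂ simpleH (π₂ x))

  L-symmetric : Symmetric L
  L-symmetric = proj₁ L-simple

  module _ {S : VSet (n * m)} (c : CycleIn L S) where
    open CycleIn c

    ClosedAt : Fin n → Set
    ClosedAt g = ∀ x y → S x ≡ true → S y ≡ true → L x y ≡ true → π₁ x ≡ g → π₁ y ≡ g

    cycle-inLayer : ∀ {g} → ClosedAt g → ∀ j → π₁ (vtx j) ≡ g → ∀ i → π₁ (vtx i) ≡ g
    cycle-inLayer {g} closed j j∈g = inject₁-induction (λ i → π₁ (vtx i) ≡ g) (back j j∈g)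
                                                      (λ i i∈g → closed _ _ (inX _) (inX _) (step i) i∈g)
      where
      back : ∀ i → π₁ (vtx i) ≡ g → π₁ (vtx zero) ≡ g
      back = inject₁-induction (λ i → π₁ (vtx i) ≡ g → π₁ (vtx zero) ≡ g) (λ e → e)
        (λ i back-i i∈g → back-i (closed _ _ (inX _) (inX _) (trans (L-symmetric _ _) (step i)) i∈g))

    layerCycle : ∀ {g T} → (∀ i → π₁ (vtx i) ≡ g) → (∀ i → T (π₂ (vtx i)) ≡ true) → CycleIn H T
    layerCycle {g} {T} inLayer inT = map-cycle c H T π₂
      (λ i j e → π-injective (trans (inLayer i) (sym (inLayer j))) e) inT
      (λ i j → L-sameLayer⇒H _ _ (trans (inLayer i) (sym (inLayer j))))

  liftCycle : ∀ g {T Y} → (∀ h → T h ≡ true → Y ⟨ g , h ⟩ ≡ true) → CycleIn H T → CycleIn L Y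
  liftCycle g {T} {Y} T⊆Y c = map-cycle c L Y ⟨ g ,_⟩
    (λ i j e → combine-injectiveʳ {n} {m} g _ g _ e) (λ i → T⊆Y _ (CycleIn.inX c i))
    (λ i j → ⟨⟩-adjacentᴴ g)

  infixl 25 _⊠_

  _⊠_ : VSet n → VSet m → VSet (n * m)
  (I ⊠ T) x = I (π₁ x) ∧ T (π₂ x)

  ⟨⟩∈⊠ : ∀ {I T g h} → I g ≡ true → T h ≡ true → (I ⊠ T) ⟨ g , h ⟩ ≡ true
  ⟨⟩∈⊠ {I} {T} {g} {h} Ig Th rewrite π₁-⟨⟩ g h | π₂-⟨⟩ g h | Ig | Th = refl

  ⊠-isForest : ∀ {I T} → IsIndependent G I → IsForest H T → IsForest L (I ⊠ T)
  ⊠-isForest {I} {T} independent forest c =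
    forest (layerCycle c (cycle-inLayer c closed zero refl) (λ i → proj₂ (∧-true⁻ (inX i))))
    where
    open CycleIn c
    closed : ClosedAt c (π₁ (vtx zero))
    closed x y Sx Sy xy x∈g with L-adjacent⁻ x y xy
    ... | inj₂ (x₁≡y₁ , _) = trans (sym x₁≡y₁) x∈g
    ... | inj₁ Gxy with () ← trans (sym Gxy) (independent _ _ (proj₁ (∧-true⁻ Sx)) (proj₁ (∧-true⁻ Sy)))

  -- A vertex (g , h) outside I ⊠ T either closes a cycle of T inside layer g (when g ∈ I),
  -- or a triangle with an edge of T in the layer of a neighbour of g in I.
  ⊠-isMaxForest : ∀ {I T} → IsMaxIndependent G I → IsMaxForest H T → HasEdge H → IsMaxForest L (I ⊠ T)
  ⊠-isMaxForest {I} {T} maxI maxT edgeH = ⊠-isForest (proj₁ maxI) (proj₁ maxT) , maximal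
    where
    maximal : ∀ Y → I ⊠ T ⊂ Y → ¬ IsForest L Y
    maximal Y (⊠⊆Y , y , y∉⊠ , Yy) forestY with I (π₁ y) in Ig
    ... | true = proj₂ maxT (insert T (π₂ y)) (⊂-insert T (π₂ y) y∉⊠) (λ c → forestY (liftCycle (π₁ y) layer⊆Y c))
      where
      layer⊆Y : ∀ h → insert T (π₂ y) h ≡ true → Y ⟨ π₁ y , h ⟩ ≡ true
      layer⊆Y h Th′ with insert⁻ T (π₂ y) h Th′
      ... | inj₁ Th″ = ⊠⊆Y _ (⟨⟩∈⊠ {I} {T} Ig Th″)
      ... | inj₂ refl = subst (λ x → Y x ≡ true) (sym (⟨π₁,π₂⟩ y)) Yy
    ... | false with maxIndependent-dominating simpleG maxI (π₁ y) Ig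
                  | maxForest-hasEdge (proj₁ simpleH) maxT edgeH
    ...   | g′ , Ig′ , yg′ | t₁ , t₂ , Tt₁ , Tt₂ , t₁t₂ =
      forestY (triangle L Y y ⟨ g′ , t₁ ⟩ ⟨ g′ , t₂ ⟩
                 (y≢ t₁) (⟨⟩-≢₂ (adjacent⇒≢ simpleH t₁t₂)) (y≢ t₂)
                 (subst (λ x → L x ⟨ g′ , t₁ ⟩ ≡ true) (⟨π₁,π₂⟩ y) (⟨⟩-adjacentᴳ _ _ yg′))
                 (⟨⟩-adjacentᴴ g′ t₁t₂)
                 (subst (λ x → L ⟨ g′ , t₂ ⟩ x ≡ true) (⟨π₁,π₂⟩ y) (⟨⟩-adjacentᴳ _ _ (trans (proj₁ simpleG _ _) yg′)))
                 Yy (⊠⊆Y _ (⟨⟩∈⊠ {I} {T} Ig′ Tt₁)) (⊠⊆Y _ (⟨⟩∈⊠ {I} {T} Ig′ Tt₂)))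
      where
      y≢ : ∀ t → ¬ y ≡ ⟨ g′ , t ⟩
      y≢ t e = ⟨⟩-≢₁ (adjacent⇒≢ simpleG yg′) (trans (⟨π₁,π₂⟩ y) e)

  size-⊠ : ∀ I T → size (I ⊠ T) ≡ size I * size T
  size-⊠ I T = begin
      count (I ⊠ T)
    ≡⟨ count-remQuot n m (λ g h → I g ∧ T h) ⟩
      sumF (λ g → count (λ h → I g ∧ T h))
    ≡⟨ sumF-cong layer ⟩
      sumF (λ g → count T * ind (I g))
    ≡⟨ sumF-* (count T) (λ g → ind (I g)) ⟩
      count T * sumF (λ g → ind (I g))
    ≡⟨ cong (count T *_) (sym (count≡sumF I)) ⟩
      count T * count I
    ≡⟨ *-comm (count T) (count I) ⟩
      count I * count T
    ∎
    where
    open ≡-Reasoning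
    layer : ∀ g → count (λ h → I g ∧ T h) ≡ count T * ind (I g)
    layer g with I g
    ... | true  = sym (*-identityʳ _)
    ... | false = trans (count-false {m}) (sym (*-zeroʳ (count T)))

-- Isolated vertices, leaves and K₂-components of an induced subgraph

module ForestParts {n} {G : Graph n} (simpleG : IsSimple G) (F : VSet n) where

  private
    G-sym : Symmetric G
    G-sym = proj₁ simpleG

  isolated leaf : Fin n → Bool
  isolated = isolatedB G F
  leaf     = leafB G F

  k2Pair : Fin n → Fin n → Bool
  k2Pair = k2PairB G F

  upperK2 lowerK2 : Fin n → Bool
  upperK2 v = anyB (λ u → (toℕ u <ᵇ toℕ v) ∧ k2Pair u v)
  lowerK2 v = anyB (λ u → (toℕ v <ᵇ toℕ u) ∧ k2Pair v u)

  -- The vertices of F whose layer in the forest of part (4) is M: the leaves of F, except that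
  -- only the lower end of a K₂-component counts.
  mType : Fin n → Bool
  mType v = leaf v ∧ not (upperK2 v)

  pointType : Fin n → Bool
  pointType v = F v ∧ not (isolated v) ∧ not (mType v)

  isolated⇒∈F : ∀ {g} → isolated g ≡ true → F g ≡ true
  isolated⇒∈F Ig = proj₁ (∧-true⁻ Ig)

  leaf⇒∈F : ∀ {g} → leaf g ≡ true → F g ≡ true
  leaf⇒∈F Lg = proj₁ (∧-true⁻ Lg)

  isolated-noNeighbour : ∀ {g w} → isolated g ≡ true → F w ≡ true → G g w ≡ false
  isolated-noNeighbour {g} {w} Ig Fw =
    subst (_≡ false) (cong (_∧ G g w) Fw) (count-zero⁻ _ (≡ᵇ-true⁻ (proj₂ (∧-true⁻ Ig))) w)

  leaf-neighbour : ∀ {g} → leaf g ≡ true → Σ _ λ w → (F w ≡ true) × (G g w ≡ true)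
  leaf-neighbour {g} Lg with count-pos⁻ (λ u → F u ∧ G g u) (≤-reflexive (sym (≡ᵇ-true⁻ (proj₂ (∧-true⁻ Lg)))))
  ... | w , Fw∧gw = w , ∧-true⁻ Fw∧gw

  leaf-uniqueNeighbour : ∀ {g a b} → leaf g ≡ true → F a ≡ true → G g a ≡ true → F b ≡ true → G g b ≡ true → a ≡ b
  leaf-uniqueNeighbour {g} Lg Fa ga Fb gb = count≡1⁻ (λ u → F u ∧ G g u) (≡ᵇ-true⁻ (proj₂ (∧-true⁻ Lg))) _ _
    (cong₂ _∧_ Fa ga) (cong₂ _∧_ Fb gb)

  nonLeaf⇒twoNeighbours : ∀ {g} → F g ≡ true → isolated g ≡ false → leaf g ≡ false
                        → Σ _ λ a → Σ _ λ b → (¬ a ≡ b) × (F a ≡ true) × (G g a ≡ true) × (F b ≡ true) × (G g b ≡ true)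
  nonLeaf⇒twoNeighbours {g} Fg Ig Lg with count≥2⁻ (λ u → F u ∧ G g u) (degree≥2 (degIn G F g) Fg Ig Lg)
    where
    degree≥2 : ∀ d → F g ≡ true → F g ∧ (d ≡ᵇ 0) ≡ false → F g ∧ (d ≡ᵇ 1) ≡ false → 2 ≤ d
    degree≥2 zero          Fg Ig Lg rewrite Fg with () ← Ig
    degree≥2 (suc zero)    Fg Ig Lg rewrite Fg with () ← Lg
    degree≥2 (suc (suc d)) _  _  _  = s≤s (s≤s z≤n)
  ... | a , b , a≢b , Fa∧ga , Fb∧gb with ∧-true⁻ Fa∧ga | ∧-true⁻ Fb∧gb
  ...   | Fa , ga | Fb , gb = a , b , a≢b , Fa , ga , Fb , gb

  record K2Pair (u v : Fin n) : Set where
    field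
      leafᵘ : leaf u ≡ true
      leafᵛ : leaf v ≡ true
      ∈Fᵘ   : F u ≡ true
      ∈Fᵛ   : F v ≡ true
      edge  : G u v ≡ true

  k2Pair⁻ : ∀ {u v} → k2Pair u v ≡ true → K2Pair u v
  k2Pair⁻ {u} {v} e with ∧-true⁻ e
  ... | Lu , e₁ with ∧-true⁻ e₁
  ... | Lv , e₂ with ∧-true⁻ e₂
  ... | Fu , e₃ with ∧-true⁻ e₃
  ... | Fv , uv = record { leafᵘ = Lu ; leafᵛ = Lv ; ∈Fᵘ = Fu ; ∈Fᵛ = Fv ; edge = uv }

  k2Pair-intro : ∀ {u v} → K2Pair u v → k2Pair u v ≡ true
  k2Pair-intro p rewrite K2Pair.leafᵘ p | K2Pair.leafᵛ p | K2Pair.∈Fᵘ p | K2Pair.∈Fᵛ p | K2Pair.edge p = refl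

  k2Pair-sym : ∀ {u v} → k2Pair u v ≡ true → k2Pair v u ≡ true
  k2Pair-sym e = k2Pair-intro (record { leafᵘ = leafᵛ ; leafᵛ = leafᵘ ; ∈Fᵘ = ∈Fᵛ ; ∈Fᵛ = ∈Fᵘ ; edge = trans (G-sym _ _) edge })
    where open K2Pair (k2Pair⁻ e)

  k2Pair-uniqueˡ : ∀ {v a b} → k2Pair a v ≡ true → k2Pair b v ≡ true → a ≡ b
  k2Pair-uniqueˡ pa pb = leaf-uniqueNeighbour (K2Pair.leafᵛ (k2Pair⁻ pa))
    (K2Pair.∈Fᵘ (k2Pair⁻ pa)) (trans (G-sym _ _) (K2Pair.edge (k2Pair⁻ pa)))
    (K2Pair.∈Fᵘ (k2Pair⁻ pb)) (trans (G-sym _ _) (K2Pair.edge (k2Pair⁻ pb)))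

  ordered-k2Pair : ∀ {u v} → toℕ u < toℕ v → k2Pair u v ≡ true → (toℕ u <ᵇ toℕ v) ∧ k2Pair u v ≡ true
  ordered-k2Pair u<v p rewrite <ᵇ-true u<v | p = refl

  upperK2⁻ : ∀ {v} → upperK2 v ≡ true → Σ _ λ u → (toℕ u < toℕ v) × (k2Pair u v ≡ true)
  upperK2⁻ {v} e with anyB⁻ _ e
  ... | u , e′ = u , <ᵇ-true⁻ (proj₁ (∧-true⁻ {toℕ u <ᵇ toℕ v} e′)) , proj₂ (∧-true⁻ {toℕ u <ᵇ toℕ v} e′)

  lowerK2⁻ : ∀ {v} → lowerK2 v ≡ true → Σ _ λ u → (toℕ v < toℕ u) × (k2Pair v u ≡ true)
  lowerK2⁻ {v} e with anyB⁻ _ e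
  ... | u , e′ = u , <ᵇ-true⁻ (proj₁ (∧-true⁻ {toℕ v <ᵇ toℕ u} e′)) , proj₂ (∧-true⁻ {toℕ v <ᵇ toℕ u} e′)

  mType⇒leaf : ∀ {g} → mType g ≡ true → leaf g ≡ true
  mType⇒leaf e = proj₁ (∧-true⁻ e)

  mType⇒¬upperK2 : ∀ {g} → mType g ≡ true → upperK2 g ≡ false
  mType⇒¬upperK2 {g} e with upperK2 g
  ... | false = refl
  ... | true with () ← proj₂ (∧-true⁻ {leaf g} e)

  leaf∧¬mType⇒upperK2 : ∀ {g} → leaf g ≡ true → mType g ≡ false → upperK2 g ≡ true
  leaf∧¬mType⇒upperK2 {g} Lg ¬Mg with upperK2 g | trans (sym (cong (λ l → l ∧ not (upperK2 g)) Lg)) ¬Mg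
  ... | true | _ = refl

  mType⇒¬isolated : ∀ {g} → mType g ≡ true → isolated g ≡ false
  mType⇒¬isolated {g} e with isolated g in Ig
  ... | false = refl
  ... | true  = ⊥-elim (true≢false (trans (sym (proj₂ (∧-true⁻ {F g} (mType⇒leaf e))))
                  (cong (_≡ᵇ 1) (≡ᵇ-true⁻ {degIn G F g} (proj₂ (∧-true⁻ {F g} Ig))))))

  lower-k2Pair⇒mType : ∀ {u v} → toℕ u < toℕ v → k2Pair u v ≡ true → mType u ≡ true
  lower-k2Pair⇒mType {u} {v} u<v p = cong₂ (λ a b → a ∧ not b) leafᵘ notUpper
    where
    open K2Pair (k2Pair⁻ p)
    notUpper : upperK2 u ≡ false
    notUpper with upperK2 u in e
    ... | false = refl
    ... | true with upperK2⁻ e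
    ...   | w , w<u , pw with k2Pair-uniqueˡ (k2Pair-sym p) pw
    ...     | refl = ⊥-elim (<-asym u<v w<u)

  leaf⇒mType : ∀ {v} → leaf v ≡ true → Σ _ λ u → mType u ≡ true
  leaf⇒mType {v} Lv with upperK2 v in e
  ... | false = v , cong₂ (λ a b → a ∧ not b) Lv e
  ... | true with upperK2⁻ {v} e
  ...   | u , u<v , p = u , lower-k2Pair⇒mType u<v p

  mType-neighbour : ∀ {g w} → mType g ≡ true → F w ≡ true → G g w ≡ true → pointType w ≡ true
  mType-neighbour {g} {w} Mg Fw gw = trans (cong₂ (λ a b → a ∧ not b ∧ not (mType w)) Fw ¬Iw) (cong not ¬Mw)
    where
    Fg : F g ≡ true
    Fg = leaf⇒∈F (mType⇒leaf Mg)
    ¬Iw : isolated w ≡ false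
    ¬Iw with isolated w in Iw
    ... | false = refl
    ... | true with () ← trans (sym (trans (G-sym w g) gw)) (isolated-noNeighbour Iw Fg)
    ¬Mw : mType w ≡ false
    ¬Mw with mType w in Mw
    ... | false = refl
    ... | true with <-cmp (toℕ g) (toℕ w)
    ...   | tri< g<w _ _ = ⊥-elim (true≢false (trans (sym (anyB-intro _ g (ordered-k2Pair g<w pair))) (mType⇒¬upperK2 Mw)))
      where pair = k2Pair-intro (record { leafᵘ = mType⇒leaf Mg ; leafᵛ = mType⇒leaf Mw ; ∈Fᵘ = Fg ; ∈Fᵛ = Fw ; edge = gw })
    ...   | tri> _ _ w<g = ⊥-elim (true≢false (trans (sym (anyB-intro _ w (ordered-k2Pair w<g pair))) (mType⇒¬upperK2 Mg)))
      where pair = k2Pair-intro (record { leafᵘ = mType⇒leaf Mw ; leafᵛ = mType⇒leaf Mg ; ∈Fᵘ = Fw ; ∈Fᵛ = Fg ; edge = trans (G-sym w g) gw })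
    ...   | tri≈ _ g≡w _ = ⊥-elim (adjacent⇒≢ simpleG gw (toℕ-injective g≡w))

  upperK2⇒leaf : ∀ {v} → upperK2 v ≡ true → leaf v ≡ true
  upperK2⇒leaf Uv with upperK2⁻ Uv
  ... | _ , _ , p = K2Pair.leafᵛ (k2Pair⁻ p)

  lowerK2⇒leaf : ∀ {v} → lowerK2 v ≡ true → leaf v ≡ true
  lowerK2⇒leaf Lv with lowerK2⁻ Lv
  ... | _ , _ , p = K2Pair.leafᵘ (k2Pair⁻ p)

  lowerK2⇒¬upperK2 : ∀ {v} → lowerK2 v ≡ true → upperK2 v ≡ false
  lowerK2⇒¬upperK2 {v} Lv with upperK2 v in Uv
  ... | false = refl
  ... | true with upperK2⁻ {v} Uv | lowerK2⁻ Lv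
  ...   | u , u<v , pu | w , v<w , pw with k2Pair-uniqueˡ pu (k2Pair-sym pw)
  ...     | refl = ⊥-elim (<-asym u<v v<w)

  inK2≡upperK2∨lowerK2 : ∀ v → inK2B G F v ≡ upperK2 v ∨ lowerK2 v
  inK2≡upperK2∨lowerK2 v with inK2B G F v in In | upperK2 v in Uv | lowerK2 v in Lv
  ... | false | false | false = refl
  ... | true  | true  | _     = refl
  ... | true  | false | true  = refl
  ... | true  | false | false with anyB⁻ _ In
  ...   | u , p with <-cmp (toℕ u) (toℕ v)
  ...     | tri< u<v _ _ = ⊥-elim (true≢false (trans (sym (anyB-intro (λ w → (toℕ w <ᵇ toℕ v) ∧ k2Pair w v) u (ordered-k2Pair u<v p))) Uv))
  ...     | tri> _ _ v<u = ⊥-elim (true≢false (trans (sym (anyB-intro (λ w → (toℕ v <ᵇ toℕ w) ∧ k2Pair v w) u (ordered-k2Pair v<u (k2Pair-sym p)))) Lv))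
  ...     | tri≈ _ u≡v _ = ⊥-elim (adjacent⇒≢ simpleG (K2Pair.edge (k2Pair⁻ p)) (toℕ-injective u≡v))
  inK2≡upperK2∨lowerK2 v | false | true | _ with upperK2⁻ {v} Uv
  ... | u , _ , p = trans (sym In) (anyB-intro _ u p)
  inK2≡upperK2∨lowerK2 v | false | false | true with lowerK2⁻ {v} Lv
  ... | u , _ , p = trans (sym In) (anyB-intro _ u (k2Pair-sym p))

  count-upperK2 : count upperK2 ≡ K2 G F
  count-upperK2 = trans (count≡sumF upperK2) (sumF-cong λ v →
    ind-anyB≡count _ λ a b pa pb → k2Pair-uniqueˡ {v} (proj₂ (∧-true⁻ {toℕ a <ᵇ toℕ v} pa)) (proj₂ (∧-true⁻ {toℕ b <ᵇ toℕ v} pb)))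

  count-lowerK2 : count lowerK2 ≡ K2 G F
  count-lowerK2 = begin
      count lowerK2
    ≡⟨ count≡sumF lowerK2 ⟩
      sumF (λ v → ind (lowerK2 v))
    ≡⟨ sumF-cong (λ v → ind-anyB≡count _ (λ a b pa pb → k2Pair-uniqueˡ {v}
         (k2Pair-sym (proj₂ (∧-true⁻ {toℕ v <ᵇ toℕ a} pa))) (k2Pair-sym (proj₂ (∧-true⁻ {toℕ v <ᵇ toℕ b} pb))))) ⟩
      sumF (λ v → count (λ u → (toℕ v <ᵇ toℕ u) ∧ k2Pair v u))
    ≡⟨ sumF-count-swap (λ v u → (toℕ v <ᵇ toℕ u) ∧ k2Pair v u) ⟩
      K2 G F
    ∎
    where open ≡-Reasoning

  count-mType : count mType ≡ Lf G F + K2 G F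
  count-mType = trans (count-split mType _ lowerK2 split) (cong (Lf G F +_) count-lowerK2)
    where
    split : ∀ v → ind (mType v) ≡ ind (leaf v ∧ not (inK2B G F v)) + ind (lowerK2 v)
    split v rewrite inK2≡upperK2∨lowerK2 v = split′ (leaf v) (upperK2 v) (lowerK2 v) lowerK2⇒leaf lowerK2⇒¬upperK2
      where
      split′ : ∀ l u s → (s ≡ true → l ≡ true) → (s ≡ true → u ≡ false)
             → ind (l ∧ not u) ≡ ind (l ∧ not (u ∨ s)) + ind s
      split′ false u     false _ _ = refl
      split′ true  false false _ _ = refl
      split′ true  true  false _ _ = refl
      split′ true  false true  _ _ = refl
      split′ l     u     true  s⇒l s⇒¬u rewrite s⇒l refl | s⇒¬u refl = refl

  count-pointType : count pointType ≡ K2 G F + L' G F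
  count-pointType = trans (count-split pointType upperK2 _ λ v → split (F v) (upperK2 v) (degIn G F v) upperK2⇒leaf)
                          (cong (_+ L' G F) count-upperK2)
    where
    split : ∀ f u d → (u ≡ true → f ∧ (d ≡ᵇ 1) ≡ true)
          → ind (f ∧ not (f ∧ (d ≡ᵇ 0)) ∧ not ((f ∧ (d ≡ᵇ 1)) ∧ not u)) ≡ ind u + ind (f ∧ (1 <ᵇ d))
    split false false d             _ = refl
    split false true  d             leaf with () ← leaf refl
    split true  false zero          _ = refl
    split true  true  zero          leaf with () ← leaf refl
    split true  u     (suc zero)    _ with u
    ... | true  = refl
    ... | false = refl
    split true  false (suc (suc d)) _ = refl
    split true  true  (suc (suc d)) leaf with () ← leaf refl

  size≡isolated+mType+pointType : size F ≡ Iso G F + count mType + count pointType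
  size≡isolated+mType+pointType =
    trans (count-split F (λ v → isolated v ∨ mType v) pointType
                       λ v → ind-∨-complement (F v) (isolated v) (mType v) isolated⇒∈F (λ Mv → leaf⇒∈F (mType⇒leaf Mv)))
          (cong (_+ count pointType) (count-split _ isolated mType λ v → ind-∨-disjoint (isolated v) (mType v) mType⇒¬isolated))

  pointType⁻ : ∀ {g} → pointType g ≡ true → (F g ≡ true) × (isolated g ≡ false) × (mType g ≡ false)
  pointType⁻ {g} e with F g | isolated g | mType g
  ... | true | false | false = refl , refl , refl

  ∈F-trichotomy : ∀ {g} → F g ≡ true → (isolated g ≡ true) ⊎ (mType g ≡ true) ⊎ (pointType g ≡ true)
  ∈F-trichotomy {g} Fg with isolated g in Ig | mType g in Mg
  ... | true  | _     = inj₁ refl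
  ... | false | true  = inj₂ (inj₁ refl)
  ... | false | false rewrite Fg = inj₂ (inj₂ refl)

-- A maximal forest of G ∘ H with the size in part (4)

module ProductForest {n m} {G : Graph n} {H : Graph m} (simpleG : IsSimple G) (simpleH : IsSimple H)
  {F : VSet n} (maxF : IsMaxForest G F) {M : VSet m} (maxM : IsMaxIndependent H M) {T : VSet m} (maxT : IsMaxForest H T)
  (h₀ : Fin m) (h₀∈M : M h₀ ≡ true) (t₀ : Fin m) (t₀∈T : T t₀ ≡ true) where

  open LexProduct simpleG simpleH
  open ForestParts simpleG F

  point : VSet m
  point h = ⌊ h ≟ h₀ ⌋

  layer : Fin n → VSet m
  layer g = if isolated g then T else if mType g then M else if F g then point else ∅

  X : VSet (n * m)
  X x = layer (π₁ x) (π₂ x)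

  X-⟨⟩ : ∀ g h → X ⟨ g , h ⟩ ≡ layer g h
  X-⟨⟩ g h rewrite π₁-⟨⟩ g h | π₂-⟨⟩ g h = refl

  layer-isolated : ∀ {g} → isolated g ≡ true → layer g ≡ T
  layer-isolated Ig rewrite Ig = refl

  layer-mType : ∀ {g} → mType g ≡ true → layer g ≡ M
  layer-mType {g} Mg rewrite mType⇒¬isolated Mg | Mg = refl

  layer-pointType : ∀ {g} → pointType g ≡ true → layer g ≡ point
  layer-pointType Pg with pointType⁻ Pg
  ... | Fg , Ig , Mg rewrite Ig | Mg | Fg = refl

  layer⇒∈F : ∀ {g h} → layer g h ≡ true → F g ≡ true
  layer⇒∈F {g} e with isolated g in Ig
  ... | true = isolated⇒∈F Ig
  ... | false with mType g in Mg
  ...   | true = leaf⇒∈F (mType⇒leaf Mg)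
  ...   | false with F g
  ...     | true = refl

  rep : Fin n → Fin m
  rep u = if isolated u then t₀ else h₀

  rep∈layer : ∀ {u} → F u ≡ true → layer u (rep u) ≡ true
  rep∈layer {u} Fu with ∈F-trichotomy Fu
  ... | inj₁ Iu rewrite Iu = t₀∈T
  ... | inj₂ (inj₁ Mu) rewrite mType⇒¬isolated Mu | Mu = h₀∈M
  ... | inj₂ (inj₂ Pu) = trans (cong (layer u) (rep-¬isolated (proj₁ (proj₂ (pointType⁻ Pu)))))
                               (trans (cong-app (layer-pointType Pu) h₀) (⌊≟⌋-refl h₀))
    where
    rep-¬isolated : isolated u ≡ false → rep u ≡ h₀
    rep-¬isolated Iu rewrite Iu = refl

  module _ (c : CycleIn L X) where
    open CycleIn c

    -- A layer of an isolated vertex has no L-neighbours in X outside itself, so c would be a cycle of T.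
    X-cycle-avoidsIsolated : ∀ j → isolated (π₁ (vtx j)) ≡ true → ⊥
    X-cycle-avoidsIsolated j Ig =
      proj₁ maxT (layerCycle c inLayer (λ i → trans (sym (cong-app (layer-isolated (subst (λ g → isolated g ≡ true) (sym (inLayer i)) Ig)) _)) (inX i)))
      where
      closed : ClosedAt c (π₁ (vtx j))
      closed x y Xx Xy xy x∈g with L-adjacent⁻ x y xy
      ... | inj₂ (x₁≡y₁ , _) = trans (sym x₁≡y₁) x∈g
      ... | inj₁ Gxy with () ← trans (sym (subst (λ g → G g (π₁ y) ≡ true) x∈g Gxy)) (isolated-noNeighbour Ig (layer⇒∈F Xy))
      inLayer : ∀ i → π₁ (vtx i) ≡ π₁ (vtx j)
      inLayer = cycle-inLayer c closed j refl

    private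
      inM : ∀ i → mType (π₁ (vtx i)) ≡ true → M (π₂ (vtx i)) ≡ true
      inM i Mi = trans (sym (cong-app (layer-mType Mi) _)) (inX i)

    cycle-mLayer-neighbour : ∀ j → mType (π₁ (vtx j)) ≡ true → ∀ p → L (vtx j) (vtx p) ≡ true
                           → (F (π₁ (vtx p)) ≡ true) × (G (π₁ (vtx j)) (π₁ (vtx p)) ≡ true) × (π₂ (vtx p) ≡ h₀)
    cycle-mLayer-neighbour j Mg p jp with L-adjacent⁻ (vtx j) (vtx p) jp
    ... | inj₂ (j₁≡p₁ , Hjp) =
      ⊥-elim (true≢false (trans (sym Hjp) (proj₁ maxM _ _ (inM j Mg) (inM p (subst (λ g → mType g ≡ true) j₁≡p₁ Mg)))))
    ... | inj₁ Gjp = Fp , Gjp , ⌊≟⌋-true⁻ (trans (sym (cong-app (layer-pointType (mType-neighbour Mg Fp Gjp)) _)) (inX p))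
      where
      Fp : F (π₁ (vtx p)) ≡ true
      Fp = layer⇒∈F (inX p)

    -- Both cycle-neighbours of a vertex in the layer M of a leaf g lie over the unique neighbour of g, at h₀.
    X-cycle-avoidsMType : ∀ j → mType (π₁ (vtx j)) ≡ true → ⊥
    X-cycle-avoidsMType j Mg with cycle-neighbours c L-symmetric j
    ... | p , s , p≢s , jp , js with cycle-mLayer-neighbour j Mg p jp | cycle-mLayer-neighbour j Mg s js
    ...   | Fp , gp , p₂ | Fs , gs , s₂ =
      p≢s (inj (π-injective (leaf-uniqueNeighbour (mType⇒leaf Mg) Fp gp Fs gs) (trans p₂ (sym s₂))))

    X-cycle-notAllPointType : (∀ j → pointType (π₁ (vtx j)) ≡ true) → ⊥
    X-cycle-notAllPointType allPoint = proj₁ maxF (map-cycle c G F π₁ sameLayer⇒≡ (λ i → layer⇒∈F (inX i)) G-edge)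
      where
      at-h₀ : ∀ i → π₂ (vtx i) ≡ h₀
      at-h₀ i = ⌊≟⌋-true⁻ (trans (sym (cong-app (layer-pointType (allPoint i)) _)) (inX i))
      sameLayer⇒≡ : ∀ i j → π₁ (vtx i) ≡ π₁ (vtx j) → vtx i ≡ vtx j
      sameLayer⇒≡ i j e = π-injective e (trans (at-h₀ i) (sym (at-h₀ j)))
      G-edge : ∀ i j → L (vtx i) (vtx j) ≡ true → G (π₁ (vtx i)) (π₁ (vtx j)) ≡ true
      G-edge i j ij with L-adjacent⁻ (vtx i) (vtx j) ij
      ... | inj₁ Gij = Gij
      ... | inj₂ (i₁≡j₁ , _) = ⊥-elim (true≢false (trans (sym (subst (λ z → L (vtx i) z ≡ true) (sym (sameLayer⇒≡ i j i₁≡j₁)) ij))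
                                                        (proj₂ L-simple (vtx i))))

  X-isForest : IsForest L X
  X-isForest c = X-cycle-notAllPointType c pointTypeAt
    where
    pointTypeAt : ∀ j → pointType (π₁ (CycleIn.vtx c j)) ≡ true
    pointTypeAt j with ∈F-trichotomy (layer⇒∈F (CycleIn.inX c j))
    ... | inj₁ Ig        = ⊥-elim (X-cycle-avoidsIsolated c j Ig)
    ... | inj₂ (inj₁ Mg) = ⊥-elim (X-cycle-avoidsMType c j Mg)
    ... | inj₂ (inj₂ Pg) = Pg

  module _ {Y : VSet (n * m)} (X⊆Y : X ⊆ Y) (forestY : IsForest L Y) where

    private
      layer⊆Y : ∀ {g h} → layer g h ≡ true → Y ⟨ g , h ⟩ ≡ true
      layer⊆Y {g} {h} e = X⊆Y _ (trans (X-⟨⟩ g h) e)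

      rep∈Y : ∀ {u} → F u ≡ true → Y ⟨ u , rep u ⟩ ≡ true
      rep∈Y Fu = layer⊆Y (rep∈layer Fu)

      ⟨⟩-adjacentᴳ′ : ∀ {g g′} h h′ → G g g′ ≡ true → L ⟨ g′ , h′ ⟩ ⟨ g , h ⟩ ≡ true
      ⟨⟩-adjacentᴳ′ h h′ gg′ = ⟨⟩-adjacentᴳ h′ h (trans (proj₁ simpleG _ _) gg′)

    -- A cycle of F + g is lifted to G ∘ H along g ↦ (g , h) and u ↦ (u , rep u).
    Y-onlyOverF : ∀ {g h} → Y ⟨ g , h ⟩ ≡ true → F g ≡ false → ⊥
    Y-onlyOverF {g} {h} Ygh Fg = proj₂ maxF (insert F g) (⊂-insert F g Fg) (λ c → forestY (lift c))
      where
      rep′ : Fin n → Fin m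
      rep′ u = if ⌊ u ≟ g ⌋ then h else rep u
      rep′∈Y : ∀ u → insert F g u ≡ true → Y ⟨ u , rep′ u ⟩ ≡ true
      rep′∈Y u e with insert⁻ F g u e
      ... | inj₂ refl rewrite ⌊≟⌋-refl g = Ygh
      ... | inj₁ Fu rewrite ⌊≟⌋-false {u = u} {v = g} (λ { refl → true≢false (trans (sym Fu) Fg) }) = rep∈Y Fu
      lift : CycleIn G (insert F g) → CycleIn L Y
      lift c = map-cycle c L Y (λ u → ⟨ u , rep′ u ⟩)
        (λ i j e → combine-injectiveˡ {n} {m} _ _ _ _ e) (λ i → rep′∈Y _ (CycleIn.inX c i)) (λ i j → ⟨⟩-adjacentᴳ _ _)

    Y-isolatedLayer : ∀ {g h} → Y ⟨ g , h ⟩ ≡ true → isolated g ≡ true → T h ≡ true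
    Y-isolatedLayer {g} {h} Ygh Ig with T h in Th
    ... | true  = refl
    ... | false = ⊥-elim (proj₂ maxT (insert T h) (⊂-insert T h Th) (λ c → forestY (liftCycle g T+h⊆Y c)))
      where
      T+h⊆Y : ∀ h′ → insert T h h′ ≡ true → Y ⟨ g , h′ ⟩ ≡ true
      T+h⊆Y h′ e with insert⁻ T h h′ e
      ... | inj₁ Th′  = layer⊆Y (trans (cong-app (layer-isolated Ig) h′) Th′)
      ... | inj₂ refl = Ygh

    -- A neighbour x ∈ M of h and the neighbour w of the leaf g give the triangle (g,h) (g,x) (w, rep w).
    Y-mLayer : ∀ {g h} → Y ⟨ g , h ⟩ ≡ true → mType g ≡ true → M h ≡ true
    Y-mLayer {g} {h} Ygh Mg with M h in Mh
    ... | true  = refl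
    ... | false with maxIndependent-dominating simpleH maxM h Mh | leaf-neighbour (mType⇒leaf Mg)
    ...   | x , Mx , hx | w , Fw , gw = ⊥-elim (forestY (triangle L Y ⟨ g , h ⟩ ⟨ g , x ⟩ ⟨ w , rep w ⟩
            (⟨⟩-≢₂ (adjacent⇒≢ simpleH hx)) (⟨⟩-≢₁ (adjacent⇒≢ simpleG gw)) (⟨⟩-≢₁ (adjacent⇒≢ simpleG gw))
            (⟨⟩-adjacentᴴ g hx) (⟨⟩-adjacentᴳ _ _ gw) (⟨⟩-adjacentᴳ′ _ _ gw)
            Ygh (layer⊆Y (trans (cong-app (layer-mType Mg) x) Mx)) (rep∈Y Fw)))

    Y-pointLayer-nonLeaf : ∀ {g h} → Y ⟨ g , h ⟩ ≡ true → pointType g ≡ true → leaf g ≡ false → ¬ h ≡ h₀ → ⊥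
    Y-pointLayer-nonLeaf {g} {h} Ygh Pg Lg h≢h₀ with pointType⁻ Pg
    ... | Fg , Ig , _ with nonLeaf⇒twoNeighbours Fg Ig Lg
    ...   | a , b , a≢b , Fa , ga , Fb , gb = forestY (square L Y ⟨ g , h ⟩ ⟨ a , rep a ⟩ ⟨ g , h₀ ⟩ ⟨ b , rep b ⟩
            (⟨⟩-≢₁ (adjacent⇒≢ simpleG ga)) (⟨⟩-≢₂ h≢h₀) (⟨⟩-≢₁ (adjacent⇒≢ simpleG gb))
            (⟨⟩-≢₁ (≢-sym (adjacent⇒≢ simpleG ga))) (⟨⟩-≢₁ a≢b) (⟨⟩-≢₁ (adjacent⇒≢ simpleG gb))
            (⟨⟩-adjacentᴳ _ _ ga) (⟨⟩-adjacentᴳ′ _ _ ga) (⟨⟩-adjacentᴳ _ _ gb) (⟨⟩-adjacentᴳ′ _ _ gb)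
            Ygh (rep∈Y Fa) (layer⊆Y (trans (cong-app (layer-pointType Pg) h₀) (⌊≟⌋-refl h₀))) (rep∈Y Fb))

    private
      module K2Component {g u} (Pg : pointType g ≡ true) (u<g : toℕ u < toℕ g) (pair : k2Pair u g ≡ true) where
        gu : G g u ≡ true
        gu = trans (proj₁ simpleG g u) (K2Pair.edge (k2Pair⁻ pair))
        g≢u : ¬ g ≡ u
        g≢u = adjacent⇒≢ simpleG gu
        gh₀∈Y : Y ⟨ g , h₀ ⟩ ≡ true
        gh₀∈Y = layer⊆Y (trans (cong-app (layer-pointType Pg) h₀) (⌊≟⌋-refl h₀))
        M⊆Y : ∀ {x} → M x ≡ true → Y ⟨ u , x ⟩ ≡ true
        M⊆Y Mx = layer⊆Y (trans (cong-app (layer-mType (lower-k2Pair⇒mType u<g pair)) _) Mx)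

    Y-k2Component-square : ∀ {g h u} → Y ⟨ g , h ⟩ ≡ true → pointType g ≡ true → toℕ u < toℕ g → k2Pair u g ≡ true
                         → ¬ h ≡ h₀ → ∀ {x} → M x ≡ true → ¬ x ≡ h₀ → ⊥
    Y-k2Component-square {g} {h} {u} Ygh Pg u<g pair h≢h₀ {x} Mx x≢h₀ =
      forestY (square L Y ⟨ g , h ⟩ ⟨ u , x ⟩ ⟨ g , h₀ ⟩ ⟨ u , h₀ ⟩
        (⟨⟩-≢₁ g≢u) (⟨⟩-≢₂ h≢h₀) (⟨⟩-≢₁ g≢u) (⟨⟩-≢₁ (≢-sym g≢u)) (⟨⟩-≢₂ x≢h₀) (⟨⟩-≢₁ g≢u)
        (⟨⟩-adjacentᴳ _ _ gu) (⟨⟩-adjacentᴳ′ _ _ gu) (⟨⟩-adjacentᴳ _ _ gu) (⟨⟩-adjacentᴳ′ _ _ gu)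
        Ygh (M⊆Y Mx) gh₀∈Y (M⊆Y h₀∈M))
      where open K2Component Pg u<g pair

    -- Here M = {h₀} is maximal, so h is adjacent to h₀.
    Y-k2Component-triangle : ∀ {g h u} → Y ⟨ g , h ⟩ ≡ true → pointType g ≡ true → toℕ u < toℕ g → k2Pair u g ≡ true
                           → ¬ h ≡ h₀ → (∀ x → M x ≡ true → x ≡ h₀) → ⊥
    Y-k2Component-triangle {g} {h} {u} Ygh Pg u<g pair h≢h₀ M⊆h₀ with maxIndependent-dominating simpleH maxM h h∉M
      where
      h∉M : M h ≡ false
      h∉M = implies-false (λ Mh → ⊥-elim (h≢h₀ (M⊆h₀ h Mh))) refl
    ... | x , Mx , hx with M⊆h₀ x Mx
    ...   | refl = forestY (triangle L Y ⟨ g , h ⟩ ⟨ g , h₀ ⟩ ⟨ u , h₀ ⟩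
            (⟨⟩-≢₂ h≢h₀) (⟨⟩-≢₁ g≢u) (⟨⟩-≢₁ g≢u)
            (⟨⟩-adjacentᴴ g hx) (⟨⟩-adjacentᴳ _ _ gu) (⟨⟩-adjacentᴳ′ _ _ gu)
            Ygh gh₀∈Y (M⊆Y h₀∈M))
      where open K2Component Pg u<g pair

    -- g is the upper end of a K₂-component {u , g}, whose lower end u carries the layer M.
    Y-pointLayer-leaf : ∀ {g h} → Y ⟨ g , h ⟩ ≡ true → pointType g ≡ true → leaf g ≡ true → ¬ h ≡ h₀ → ⊥
    Y-pointLayer-leaf {g} {h} Ygh Pg Lg h≢h₀ with upperK2⁻ (leaf∧¬mType⇒upperK2 Lg (proj₂ (proj₂ (pointType⁻ Pg))))
    ... | u , u<g , pair with anyB (λ x → M x ∧ not (point x)) in other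
    ...   | true with anyB⁻ (λ x → M x ∧ not (point x)) other
    ...     | x , Mx∧x≢h₀ = Y-k2Component-square Ygh Pg u<g pair h≢h₀ (proj₁ (∧-true⁻ Mx∧x≢h₀))
                              (λ { refl → true≢false (trans (sym (proj₂ (∧-true⁻ Mx∧x≢h₀))) (cong not (⌊≟⌋-refl h₀))) })
    Y-pointLayer-leaf {g} {h} Ygh Pg Lg h≢h₀ | u , u<g , pair | false = Y-k2Component-triangle Ygh Pg u<g pair h≢h₀ M⊆h₀
      where
      M⊆h₀ : ∀ x → M x ≡ true → x ≡ h₀
      M⊆h₀ x Mx with x ≟ h₀
      ... | yes x≡h₀ = x≡h₀
      ... | no x≢h₀  = ⊥-elim (true≢false (trans (sym (cong₂ (λ a b → a ∧ not b) Mx (⌊≟⌋-false x≢h₀))) (anyB-false⁻ (λ x → M x ∧ not (point x)) other x)))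

    Y-pointLayer : ∀ {g h} → Y ⟨ g , h ⟩ ≡ true → pointType g ≡ true → h ≡ h₀
    Y-pointLayer {g} {h} Ygh Pg with h ≟ h₀ | false⊎true (leaf g)
    ... | yes h≡h₀ | _        = h≡h₀
    ... | no h≢h₀  | inj₂ Lg  = ⊥-elim (Y-pointLayer-leaf Ygh Pg Lg h≢h₀)
    ... | no h≢h₀  | inj₁ ¬Lg = ⊥-elim (Y-pointLayer-nonLeaf Ygh Pg ¬Lg h≢h₀)

    Y⊆X : ∀ {g h} → Y ⟨ g , h ⟩ ≡ true → layer g h ≡ true
    Y⊆X {g} {h} Ygh with false⊎true (F g)
    ... | inj₁ Fg = ⊥-elim (Y-onlyOverF Ygh Fg)
    ... | inj₂ Fg with ∈F-trichotomy Fg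
    ...   | inj₁ Ig        = trans (cong-app (layer-isolated Ig) h) (Y-isolatedLayer Ygh Ig)
    ...   | inj₂ (inj₁ Mg) = trans (cong-app (layer-mType Mg) h) (Y-mLayer Ygh Mg)
    ...   | inj₂ (inj₂ Pg) = trans (cong-app (layer-pointType Pg) h)
                                   (subst (λ h′ → point h′ ≡ true) (sym (Y-pointLayer Ygh Pg)) (⌊≟⌋-refl h₀))

  X-isMaxForest : IsMaxForest L X
  X-isMaxForest = X-isForest , maximal
    where
    maximal : ∀ Y → X ⊂ Y → ¬ IsForest L Y
    maximal Y (X⊆Y , y , y∉X , y∈Y) forestY =
      true≢false (trans (sym (Y⊆X X⊆Y forestY (trans (cong Y (⟨π₁,π₂⟩ y)) y∈Y))) y∉X)

  weight : Bool → Bool → Bool → ℕ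
  weight i μ p = size T * ind i + size M * ind μ + ind p

  weight-cong : ∀ {i i′ μ μ′ p p′} → i ≡ i′ → μ ≡ μ′ → p ≡ p′ → weight i μ p ≡ weight i′ μ′ p′
  weight-cong refl refl refl = refl

  count-layer : ∀ g → count (layer g) ≡ weight (isolated g) (mType g) (pointType g)
  count-layer g with false⊎true (F g)
  ... | inj₁ ¬Fg = begin
      count (layer g)  ≡⟨ count-cong {m} (λ h → implies-false (layer⇒∈F {g} {h}) ¬Fg) ⟩
      count {m} ∅      ≡⟨ count-false {m} ⟩
      0                ≡⟨ sym (cong₂ _+_ (cong₂ _+_ (*-zeroʳ (size T)) (*-zeroʳ (size M))) refl) ⟩
      weight false false false
                       ≡⟨ sym (weight-cong (implies-false isolated⇒∈F ¬Fg) (implies-false (λ Mg → leaf⇒∈F (mType⇒leaf Mg)) ¬Fg)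
                                           (implies-false (λ Pg → proj₁ (pointType⁻ Pg)) ¬Fg)) ⟩
      weight (isolated g) (mType g) (pointType g) ∎
    where open ≡-Reasoning
  ... | inj₂ Fg with ∈F-trichotomy Fg
  ...   | inj₁ Ig = begin
      count (layer g)          ≡⟨ count-cong (cong-app (layer-isolated Ig)) ⟩
      size T                   ≡⟨ sym (trans (+-identityʳ _) (trans (cong₂ _+_ (*-identityʳ (size T)) (*-zeroʳ (size M))) (+-identityʳ _))) ⟩
      weight true false false  ≡⟨ sym (weight-cong Ig (exclusive-sym mType⇒¬isolated Ig)
                                                     (exclusive-sym (λ P → proj₁ (proj₂ (pointType⁻ P))) Ig)) ⟩
      weight (isolated g) (mType g) (pointType g) ∎
    where open ≡-Reasoning
  ...   | inj₂ (inj₁ Mg) = begin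
      count (layer g)          ≡⟨ count-cong (cong-app (layer-mType Mg)) ⟩
      size M                   ≡⟨ sym (trans (+-identityʳ _) (trans (cong₂ _+_ (*-zeroʳ (size T)) (*-identityʳ (size M))) refl)) ⟩
      weight false true false  ≡⟨ sym (weight-cong (mType⇒¬isolated Mg) Mg
                                                     (exclusive-sym (λ P → proj₂ (proj₂ (pointType⁻ P))) Mg)) ⟩
      weight (isolated g) (mType g) (pointType g) ∎
    where open ≡-Reasoning
  ...   | inj₂ (inj₂ Pg) = begin
      count (layer g)          ≡⟨ count-cong (cong-app (layer-pointType Pg)) ⟩
      count point              ≡⟨ count-singleton h₀ ⟩
      1                        ≡⟨ sym (cong (_+ 1) (cong₂ _+_ (*-zeroʳ (size T)) (*-zeroʳ (size M)))) ⟩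
      weight false false true  ≡⟨ sym (weight-cong (proj₁ (proj₂ (pointType⁻ Pg))) (proj₂ (proj₂ (pointType⁻ Pg))) Pg) ⟩
      weight (isolated g) (mType g) (pointType g) ∎
    where open ≡-Reasoning

  size-X : size X ≡ size T * Iso G F + size M * count mType + count pointType
  size-X = begin
      count X
    ≡⟨ count-remQuot n m layer ⟩
      sumF (λ g → count (layer g))
    ≡⟨ sumF-cong count-layer ⟩
      sumF (λ g → size T * ind (isolated g) + size M * ind (mType g) + ind (pointType g))
    ≡⟨ sumF-+ {n} _ _ ⟩
      sumF (λ g → size T * ind (isolated g) + size M * ind (mType g)) + sumF (λ g → ind (pointType g))
    ≡⟨ cong (_+ sumF (λ g → ind (pointType g))) (sumF-+ {n} _ _) ⟩
      sumF (λ g → size T * ind (isolated g)) + sumF (λ g → size M * ind (mType g)) + sumF (λ g → ind (pointType g))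
    ≡⟨ cong₂ _+_ (cong₂ _+_ (trans (sumF-* {n} (size T) _) (cong (size T *_) (sym (count≡sumF isolated))))
                            (trans (sumF-* {n} (size M) _) (cong (size M *_) (sym (count≡sumF mType)))))
                 (sym (count≡sumF pointType)) ⟩
      size T * Iso G F + size M * count mType + count pointType
    ∎
    where open ≡-Reasoning

-- Forest and independence numbers through maximal sets

module _ {N} (K : Graph N) where

  open RawMonad (¬¬-Monad {a = 0ℓ})

  maxForest-exists : DoubleNegation (Σ _ λ Y → IsMaxForest K Y)
  maxForest-exists = (λ (Y , maxY , _) → Y , maxY) <$> extendToMaximal (IsForest K) ∅ (∅-isForest K)

  maxIndependent-exists : DoubleNegation (Σ _ λ Y → IsMaxIndependent K Y)
  maxIndependent-exists = (λ (Y , maxY , _) → Y , maxY) <$> extendToMaximal (IsIndependent K) ∅ (∅-isIndependent K)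

  maxForest-ofForestNumber : ∀ {c} → IsForestNumber K c → DoubleNegation (Σ _ λ Y → IsMaxForest K Y × size Y ≡ c)
  maxForest-ofForestNumber ((X , forestX , sizeX) , bound) = do
    Y , maxY , X⊆Y ← extendToMaximal (IsForest K) X forestX
    pure (Y , maxY , ≤-antisym (bound Y (proj₁ maxY)) (≤-trans (≤-reflexive (sym sizeX)) (count-mono X Y X⊆Y)))

  maxIndependent-ofIndepNumber : ∀ {c} → IsIndepNumber K c → DoubleNegation (Σ _ λ Y → IsMaxIndependent K Y × size Y ≡ c)
  maxIndependent-ofIndepNumber ((X , indepX , sizeX) , bound) = do
    Y , maxY , X⊆Y ← extendToMaximal (IsIndependent K) X indepX
    pure (Y , maxY , ≤-antisym (bound Y (proj₁ maxY)) (≤-trans (≤-reflexive (sym sizeX)) (count-mono X Y X⊆Y)))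

  wellFCovered⇒size≡forestNumber : WellFCovered K → ∀ {c} → IsForestNumber K c → ∀ {Z} → IsMaxForest K Z → size Z ≡ c
  wellFCovered⇒size≡forestNumber wfc number maxZ = ≡-stable do
    Y , maxY , sizeY ← maxForest-ofForestNumber number
    pure (trans (wfc _ _ maxZ maxY) sizeY)

-- Consequences of G ∘ H being well-f-covered

module WellFCoveredLex {n m} {G : Graph n} {H : Graph m} (simpleG : IsSimple G) (simpleH : IsSimple H)
                       (edgeG : HasEdge G) (edgeH : HasEdge H) where

  open LexProduct simpleG simpleH
  open RawMonad (¬¬-Monad {a = 0ℓ})

  productForest : ∀ {F M T} → IsMaxForest G F → IsMaxIndependent H M → IsMaxForest H T
                → Σ _ λ X → IsMaxForest L X
                  × (size X ≡ size T * Iso G F + size M * count (ForestParts.mType simpleG F) + count (ForestParts.pointType simpleG F))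
  productForest maxF maxM maxT = X , X-isMaxForest , size-X
    where
    open ProductForest simpleG simpleH maxF maxM maxT
      (proj₁ (maxIndependent-nonempty simpleH maxM (proj₁ edgeH))) (proj₂ (maxIndependent-nonempty simpleH maxM (proj₁ edgeH)))
      (proj₁ (maxForest-hasEdge (proj₁ simpleH) maxT edgeH)) (proj₁ (proj₂ (proj₂ (maxForest-hasEdge (proj₁ simpleH) maxT edgeH))))

  size-maxForest-pos : ∀ {T} → IsMaxForest H T → 1 ≤ size T
  size-maxForest-pos maxT with maxForest-hasEdge (proj₁ simpleH) maxT edgeH
  ... | a , _ , Ta , _ = count-pos _ a Ta

  size-maxIndependent-pos : ∀ {I} → IsMaxIndependent G I → 1 ≤ size I
  size-maxIndependent-pos maxI with maxIndependent-nonempty simpleG maxI (proj₁ edgeG)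
  ... | a , Ia = count-pos _ a Ia

  module _ (wfc : WellFCovered L) where

    ⊠-size≡ : ∀ {I I′ T T′} → IsMaxIndependent G I → IsMaxIndependent G I′ → IsMaxForest H T → IsMaxForest H T′
            → size I * size T ≡ size I′ * size T′
    ⊠-size≡ {I} {I′} {T} {T′} maxI maxI′ maxT maxT′ =
      trans (sym (size-⊠ I T)) (trans (wfc _ _ (⊠-isMaxForest maxI maxT edgeH) (⊠-isMaxForest maxI′ maxT′ edgeH)) (size-⊠ I′ T′))

    G-wellCovered : WellCovered G
    G-wellCovered I I′ maxI maxI′ = ≡-stable do
      T , maxT ← maxForest-exists H
      pure (*-cancelʳ-≡ _ _ _ {{>-nonZero (size-maxForest-pos maxT)}} (⊠-size≡ maxI maxI′ maxT maxT))

    H-wellFCovered : WellFCovered H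
    H-wellFCovered T T′ maxT maxT′ = ≡-stable do
      I , maxI ← maxIndependent-exists G
      pure (*-cancelˡ-≡ _ _ _ {{>-nonZero (size-maxIndependent-pos maxI)}} (⊠-size≡ maxI maxI maxT maxT′))

    forestNumber-lex : ∀ a b c → IsIndepNumber G a → IsForestNumber H b → IsForestNumber L c → c ≡ a * b
    forestNumber-lex a b c α f f-lex = ≡-stable do
      I , maxI , sizeI ← maxIndependent-ofIndepNumber G α
      T , maxT , sizeT ← maxForest-ofForestNumber H f
      pure (trans (sym (wellFCovered⇒size≡forestNumber L wfc f-lex (⊠-isMaxForest maxI maxT edgeH)))
                  (trans (size-⊠ I T) (cong₂ _*_ sizeI sizeT)))

    productForest-size≡ : ∀ {F M M′ T} → IsMaxForest G F → IsMaxIndependent H M → IsMaxIndependent H M′ → IsMaxForest H T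
                        → let open ForestParts simpleG F in
                          size T * Iso G F + size M * count mType + count pointType
                          ≡ size T * Iso G F + size M′ * count mType + count pointType
    productForest-size≡ maxF maxM maxM′ maxT with productForest maxF maxM maxT | productForest maxF maxM′ maxT
    ... | X , maxX , sizeX | X′ , maxX′ , sizeX′ = trans (sym sizeX) (trans (wfc _ _ maxX maxX′) sizeX′)

    forestNumber-lex-formula : ∀ F M → IsMaxForest G F → IsMaxIndependent H M
                             → ∀ fH fGH → IsForestNumber H fH → IsForestNumber L fGH
                             → fH * Iso G F + size M * (K2 G F + Lf G F) + K2 G F + L' G F ≡ fGH
    forestNumber-lex-formula F M maxF maxM fH fGH numberH numberL = ≡-stable do
      T , maxT , sizeT ← maxForest-ofForestNumber H numberH
      pure (formula T maxT sizeT (productForest maxF maxM maxT))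
      where
      open ForestParts simpleG F
      regroup : ∀ a b k l l′ → a + b * (k + l) + k + l′ ≡ a + b * (l + k) + (k + l′)
      regroup = solve-∀
      formula : ∀ T → IsMaxForest H T → size T ≡ fH
              → (Σ _ λ X → IsMaxForest L X × (size X ≡ size T * Iso G F + size M * count mType + count pointType))
              → fH * Iso G F + size M * (K2 G F + Lf G F) + K2 G F + L' G F ≡ fGH
      formula T maxT sizeT (X , maxX , sizeX) = begin
          fH * Iso G F + size M * (K2 G F + Lf G F) + K2 G F + L' G F
        ≡⟨ regroup _ (size M) (K2 G F) (Lf G F) (L' G F) ⟩
          fH * Iso G F + size M * (Lf G F + K2 G F) + (K2 G F + L' G F)
        ≡⟨ sym (cong₂ _+_ (cong₂ (λ t c → t * Iso G F + size M * c) sizeT count-mType) count-pointType) ⟩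
          size T * Iso G F + size M * count mType + count pointType
        ≡⟨ sym sizeX ⟩
          size X
        ≡⟨ wellFCovered⇒size≡forestNumber L wfc numberL maxX ⟩
          fGH
        ∎
        where open ≡-Reasoning

    H-wellCovered : (Σ (VSet n) λ F → IsMaxForest G F × Σ _ λ v → leafB G F v ≡ true) → WellCovered H
    H-wellCovered (F , maxF , v , leaf-v) M M′ maxM maxM′ = ≡-stable do
      T , maxT ← maxForest-exists H
      pure (*-cancelʳ-≡ _ _ _ {{>-nonZero count-mType-pos}}
             (+-cancelˡ-≡ (size T * Iso G F) _ _ (+-cancelʳ-≡ (count pointType) _ _ (productForest-size≡ maxF maxM maxM′ maxT))))
      where
      open ForestParts simpleG F
      count-mType-pos : 1 ≤ count mType
      count-mType-pos with leaf⇒mType leaf-v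
      ... | u , Mu = count-pos mType u Mu

    G-wellFCovered : (∀ F → IsMaxForest G F → ∀ v → ¬ (isolatedB G F v ≡ true))
                   → (Σ (VSet m) λ M → IsMaxIndependent H M × size M ≡ 1)
                   → WellFCovered G × (∀ a b → IsForestNumber G a → IsForestNumber L b → a ≡ b)
    G-wellFCovered noIsolated (M , maxM , sizeM) = wellFCovered , forestNumber≡
      where
      productForest-size≡size : ∀ {F T} → IsMaxForest G F → IsMaxForest H T → Σ _ λ X → IsMaxForest L X × size X ≡ size F
      productForest-size≡size {F} {T} maxF maxT with productForest maxF maxM maxT
      ... | X , maxX , sizeX = X , maxX , (begin
          size X                                                     ≡⟨ sizeX ⟩
          size T * Iso G F + size M * count mType + count pointType  ≡⟨ cong₂ (λ i s → size T * i + s * count mType + count pointType) Iso≡0 sizeM ⟩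
          size T * 0 + 1 * count mType + count pointType             ≡⟨ cong₂ (λ z c → z + c + count pointType) (*-zeroʳ (size T)) (*-identityˡ (count mType)) ⟩
          count mType + count pointType                              ≡⟨ cong (λ i → i + count mType + count pointType) (sym Iso≡0) ⟩
          Iso G F + count mType + count pointType                    ≡⟨ sym size≡isolated+mType+pointType ⟩
          size F                                                     ∎)
        where
        open ≡-Reasoning
        open ForestParts simpleG F
        Iso≡0 : Iso G F ≡ 0
        Iso≡0 = trans (count-cong (λ v → implies-false (λ Iv → ⊥-elim (noIsolated F maxF v Iv)) refl)) (count-false {n})
      wellFCovered : WellFCovered G
      wellFCovered F F′ maxF maxF′ = ≡-stable do
        T , maxT ← maxForest-exists H
        pure (sizes≡ (productForest-size≡size maxF maxT) (productForest-size≡size maxF′ maxT))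
        where
        sizes≡ : (Σ _ λ X → IsMaxForest L X × size X ≡ size F) → (Σ _ λ X′ → IsMaxForest L X′ × size X′ ≡ size F′)
               → size F ≡ size F′
        sizes≡ (X , maxX , sizeX) (X′ , maxX′ , sizeX′) = trans (sym sizeX) (trans (wfc _ _ maxX maxX′) sizeX′)
      forestNumber≡ : ∀ a b → IsForestNumber G a → IsForestNumber L b → a ≡ b
      forestNumber≡ a b numberG numberL = ≡-stable do
        F , maxF , sizeF ← maxForest-ofForestNumber G numberG
        T , maxT ← maxForest-exists H
        pure (number≡ {F} sizeF (productForest-size≡size maxF maxT))
        where
        number≡ : ∀ {F : VSet n} → size F ≡ a → (Σ _ λ X → IsMaxForest L X × size X ≡ size F) → a ≡ b
        number≡ sizeF (X , maxX , sizeX) = trans (sym sizeF) (trans (sym sizeX) (wellFCovered⇒size≡forestNumber L wfc numberL maxX))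

theorem3p5 : ∀ {n m} (G : Graph n) (H : Graph m)
    → IsSimple G → IsSimple H → HasEdge G → HasEdge H
    → WellFCovered (lex G H)
    → (WellCovered G
        × ((∀ F → IsMaxForest G F → ∀ v → ¬ (isolatedB G F v ≡ true))
           → (Σ (VSet m) λ M → IsMaxIndependent H M × size M ≡ 1)
           → WellFCovered G
             × (∀ a b → IsForestNumber G a → IsForestNumber (lex G H) b → a ≡ b)))
    × (WellFCovered H
        × ((Σ (VSet n) λ F → IsMaxForest G F × Σ _ λ v → leafB G F v ≡ true)
           → WellCovered H))
    × (∀ a b c → IsIndepNumber G a → IsForestNumber H b → IsForestNumber (lex G H) c
        → c ≡ a * b)
    × (∀ F M → IsMaxForest G F → IsMaxIndependent H M
        → ∀ fH fGH → IsForestNumber H fH → IsForestNumber (lex G H) fGH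
        → fH * Iso G F + size M * (K2 G F + Lf G F) + K2 G F + L' G F ≡ fGH)
theorem3p5 G H simpleG simpleH edgeG edgeH wfc =
  (G-wellCovered wfc , G-wellFCovered wfc) ,
  (H-wellFCovered wfc , H-wellCovered wfc) ,
  forestNumber-lex wfc ,
  forestNumber-lex-formula wfc
  where open WellFCoveredLex simpleG simpleH edgeG edgeH
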